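{- Let $r\geq 0$ be an integer and $k\in\mathbb{Z}$. For every integer $n\geq 0$, \[ \tilde{A}_{n}^{(r,k)}(x)=\sum_{j=0}^{n}\left\{\sum_{l=0}^{n-j}\sum_{a=0}^{n-j-l}\binom{n}{l+j}\binom{n-j-l}{a}S_{1}(l+j,j)\,B_{a}^{(a-r+1)}(1-r)\,\tilde{C}_{n-j-l-a}^{(k)}\right\}x^{j}. \]
   Context: For $k\in\mathbb{Z}$ let $\mathrm{Lif}_{k}(x)=\sum_{m=0}^{\infty}\frac{x^{m}}{m!(m+1)^{k}}$. For an integer $r\geq 0$ and $k\in\mathbb{Z}$, the polynomials $\tilde{A}_{n}^{(r,k)}(x)$ are defined by \[ \left(\frac{t}{(1+t)\log(1+t)}\right)^{r}\mathrm{Lif}_{k}\bigl(-\log(1+t)\bigr)(1+t)^{x}=\sum_{n=0}^{\infty}\tilde{A}_{n}^{(r,k)}(x)\frac{t^{n}}{n!}. \] The poly-Cauchy numbers of the second kind $\tilde{C}_{n}^{(k)}$ are defined by $\mathrm{Lif}_{k}(-\log(1+t))=\sum_{n\geq 0}\tilde{C}_{n}^{(k)}\frac{t^{n}}{n!}$. For $\alpha\in\mathbb{Z}$, the Bernoulli polynomials of order $\alpha$ are defined by $\left(\frac{t}{e^{t}-1}\right)^{\alpha}e^{xt}=\sum_{n\geq 0}B_{n}^{(\alpha)}(x)\frac{t^{n}}{n!}$. $S_{1}(n,m)$ are the Stirling numbers of the first kind, defined by $x(x-1)\cdots(x-n+1)=\sum_{m=0}^{n}S_{1}(n,m)x^{m}$.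 -}

module Defs where

open import Data.Nat as ℕ using (ℕ; zero; suc; _∸_; _!)
open import Data.Nat.Properties using (_!≢0)
open import Data.Integer as ℤ using (ℤ; +_; -[1+_])
open import Data.Rational using (ℚ; 0ℚ; 1ℚ; _+_; _*_; _-_; -_; _/_)

ℕ→ℚ : ℕ → ℚ
ℕ→ℚ n = + n / 1

ℤ→ℚ : ℤ → ℚ
ℤ→ℚ z = z / 1

_^ℚ_ : ℚ → ℕ → ℚ
q ^ℚ zero  = 1ℚ
q ^ℚ suc m = q * (q ^ℚ m)

invFact : ℕ → ℚ
invFact m = _/_ (+ 1) (m !) {{m !≢0}}

sumTo : ℕ → (ℕ → ℚ) → ℚ
sumTo zero    f = f 0
sumTo (suc n) f = sumTo n f + f (suc n)

-- Formal power series over ℚ, as coefficient sequences: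
-- f represents Σ_n f n · t^n.

Series : Set
Series = ℕ → ℚ

oneS : Series
oneS zero    = 1ℚ
oneS (suc _) = 0ℚ

_⊛_ : Series → Series → Series
(f ⊛ g) n = sumTo n (λ i → f i * g (n ∸ i))

infixl 7 _⊛_

_⊕_ : Series → Series → Series
(f ⊕ g) n = f n + g n

negS : Series → Series
negS f n = - (f n)

powS : Series → ℕ → Series
powS f zero    = oneS
powS f (suc m) = f ⊛ powS f m

-- Substitution of a series g with g 0 = 0 into Σ_m c m · u^m:
-- coefficient of t^n of Σ_m c m · g(t)^m  (only m ≤ n contribute when g 0 = 0).
subst : (ℕ → ℚ) → Series → Series
subst c g n = sumTo n (λ m → c m * powS g m n)

-- Multiplicative inverse of a series f with f 0 = 1:
-- 1/f = 1/(1 - (1 - f)) = Σ_m (1 - f)^m.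
invS : Series → Series
invS f = subst (λ _ → 1ℚ) (oneS ⊕ negS f)

onePlusT : Series
onePlusT zero          = 1ℚ
onePlusT (suc zero)    = 1ℚ
onePlusT (suc (suc _)) = 0ℚ

log1p : Series
log1p zero    = 0ℚ
log1p (suc m) = ((- 1ℚ) ^ℚ m) * (+ 1 / suc m)

log1pOverT : Series
log1pOverT m = log1p (suc m)

tOverOnePlusTLog : Series
tOverOnePlusTLog = invS (onePlusT ⊛ log1pOverT)

expCoeff : ℕ → ℚ
expCoeff = invFact

expXT : ℚ → Series
expXT x m = (x ^ℚ m) * invFact m

expm1OverT : Series
expm1OverT m = invFact (suc m)

tOverExpm1 : Series
tOverExpm1 = invS expm1OverT

tOverExpm1Pow : ℤ → Series
tOverExpm1Pow (+ n)     = powS tOverExpm1 n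
tOverExpm1Pow -[1+ n ]  = powS expm1OverT (suc n)

-- (1+t)^x = exp(x log(1+t)) = Σ_m x^m (log(1+t))^m / m!
onePlusTPow : ℚ → Series
onePlusTPow x = subst (λ m → (x ^ℚ m) * invFact m) log1p

-- Polylogarithm factorial Lif_k(u) = Σ_m u^m / (m! (m+1)^k), k ∈ ℤ

lifCoeff : ℤ → ℕ → ℚ
lifCoeff (+ p)     m = invFact m * ((+ 1 / suc m) ^ℚ p)
lifCoeff -[1+ p ]  m = invFact m * (ℕ→ℚ (suc m) ^ℚ suc p)

lifNegLog : ℤ → Series
lifNegLog k = subst (lifCoeff k) (negS log1p)

polyCauchy2 : ℕ → ℤ → ℚ
polyCauchy2 n k = ℕ→ℚ (n !) * lifNegLog k n

bernoulliOrd : ℕ → ℤ → ℚ → ℚ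
bernoulliOrd n α x = ℕ→ℚ (n !) * (tOverExpm1Pow α ⊛ expXT x) n

Atilde : ℕ → ℤ → ℕ → ℚ → ℚ
Atilde r k n x =
  ℕ→ℚ (n !) * (powS tOverOnePlusTLog r ⊛ lifNegLog k ⊛ onePlusTPow x) n

-- Signed Stirling numbers of the first kind S₁(n,m):
-- coefficients of x^m in x(x-1)...(x-n+1).  Computed by multiplying the
-- coefficient sequence of x(x-1)...(x-n+1) by (x - n):
-- [x^m] (P(x)(x-n)) = [x^{m-1}] P - n [x^m] P.
stirling1 : ℕ → ℕ → ℤ
stirling1 zero    zero    = + 1
stirling1 zero    (suc m) = + 0
stirling1 (suc n) zero    = ℤ.- ((+ n) ℤ.* stirling1 n zero)
stirling1 (suc n) (suc m) = stirling1 n m ℤ.- ((+ n) ℤ.* stirling1 n (suc m))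

-- Write P = t/((1+t) log(1+t)) and L = Lif_k(-log(1+t)). Since [t^i] (1+t)^x = Σ_j S₁(i,j) x^j / i!,
-- the coefficient n! [t^n] P^r L (1+t)^x of Ã_n^(r,k)(x) expands into the stated triple sum as soon as
-- a! [t^a] P^r = B_a^(a-r+1)(1-r); the sum over a is then the binomial convolution of P^r and L.
-- For that identity, P = W(log(1+t)) with W(u) = (e^u - 1)/u · e^(-u), and Lagrange inversion
-- (log(1+t) is the compositional inverse of e^u - 1) gives [t^a] log(1+t)^m = [u^(a-m)] (u/(e^u-1))^(a+1) e^u.
-- Hence [t^a] P^r = [u^a] (u/(e^u-1))^(a+1-r) e^((1-r)u), which is B_a^(a-r+1)(1-r)/a!.
-- Everything is computed in the ring of formal power series over ℚ, where the needed facts about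
-- exp, log and powers of log(1+t) are derived from first-order equations for θ = t·d/dt.

module Submission where

open import Defs
open import Data.Nat as ℕ using (ℕ; zero; suc; _∸_; _!; z≤n; s≤s; _≤_; _<_)
open import Data.Nat.Combinatorics using (_C_; nCk≡n!/k![n-k]!; k![n∸k]!∣n!)
import Data.Nat.Properties as ℕP
import Data.Nat.DivMod as ℕD
import Data.Nat.Solver as NS
open import Data.Integer as ℤ using (ℤ; +_; -[1+_]; +[1+_])
import Data.Integer.Properties as ℤP
import Data.Integer.Solver as ZS
open import Data.Rational using (ℚ; 0ℚ; 1ℚ; _+_; _*_; _-_; -_; _/_; toℚᵘ)
import Data.Rational.Properties as ℚP
import Data.Rational.Unnormalised as ℚᵘ
import Data.Rational.Unnormalised.Properties as ℚᵘP
import Data.Rational.Solver as RSol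
open import Level using (0ℓ)
open import Data.Product using (_,_)
open import Data.Maybe using (nothing; just; Maybe)
open import Algebra.Bundles using (CommutativeRing)
open import Algebra.Solver.Ring.AlmostCommutativeRing
  using (fromCommutativeRing; AlmostCommutativeRing; _-Raw-AlmostCommutative⟶_)
import Algebra.Solver.Ring as RingSolver
open import Relation.Nullary using (yes; no; Dec)
open import Relation.Binary.PropositionalEquality hiding (subst)
open ≡-Reasoning

module QS = RSol.+-*-Solver

toℚᵘ-/suc : ∀ (z : ℤ) (d : ℕ) → toℚᵘ (z / suc d) ℚᵘ.≃ ℚᵘ.mkℚᵘ z d
toℚᵘ-/suc z d = ℚP.toℚᵘ-fromℚᵘ (ℚᵘ.mkℚᵘ z d)

ℤ→ℚ-homo-+ : ∀ a b → ℤ→ℚ (a ℤ.+ b) ≡ ℤ→ℚ a + ℤ→ℚ b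
ℤ→ℚ-homo-+ a b = ℚP.toℚᵘ-injective (ℚᵘP.≃-trans (toℚᵘ-/suc (a ℤ.+ b) 0)
   (ℚᵘP.≃-trans step (ℚᵘP.≃-sym (ℚᵘP.≃-trans (ℚP.toℚᵘ-homo-+ (ℤ→ℚ a) (ℤ→ℚ b))
      (ℚᵘP.+-cong (toℚᵘ-/suc a 0) (toℚᵘ-/suc b 0))))))
  where
  step : ℚᵘ.mkℚᵘ (a ℤ.+ b) 0 ℚᵘ.≃ (ℚᵘ.mkℚᵘ a 0 ℚᵘ.+ ℚᵘ.mkℚᵘ b 0)
  step = ℚᵘ.*≡* (ZS.+-*-Solver.solve 2 (λ a b → (a :+ b) :* con (+ 1) := (a :* con (+ 1) :+ b :* con (+ 1)) :* con (+ 1)) refl a b)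
    where open ZS.+-*-Solver

ℤ→ℚ-homo-* : ∀ a b → ℤ→ℚ (a ℤ.* b) ≡ ℤ→ℚ a * ℤ→ℚ b
ℤ→ℚ-homo-* a b = ℚP.toℚᵘ-injective (ℚᵘP.≃-trans (toℚᵘ-/suc (a ℤ.* b) 0)
   (ℚᵘP.≃-trans step (ℚᵘP.≃-sym (ℚᵘP.≃-trans (ℚP.toℚᵘ-homo-* (ℤ→ℚ a) (ℤ→ℚ b))
      (ℚᵘP.*-cong (toℚᵘ-/suc a 0) (toℚᵘ-/suc b 0))))))
  where
  open ZS.+-*-Solver
  step : ℚᵘ.mkℚᵘ (a ℤ.* b) 0 ℚᵘ.≃ (ℚᵘ.mkℚᵘ a 0 ℚᵘ.* ℚᵘ.mkℚᵘ b 0)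
  step = ℚᵘ.*≡* (solve 2 (λ a b → (a :* b) :* con (+ 1) := (a :* b) :* con (+ 1)) refl a b)

ℤ→ℚ-homo‿- : ∀ a → ℤ→ℚ (ℤ.- a) ≡ - ℤ→ℚ a
ℤ→ℚ-homo‿- a = ℚP.toℚᵘ-injective (ℚᵘP.≃-trans (toℚᵘ-/suc (ℤ.- a) 0)
   (ℚᵘP.≃-sym (ℚᵘP.≃-trans (ℚP.toℚᵘ-homo‿- (ℤ→ℚ a)) (ℚᵘP.-‿cong (toℚᵘ-/suc a 0)))))

suc*1/suc≡1 : ∀ d → ℕ→ℚ (suc d) * (+ 1 / suc d) ≡ 1ℚ
suc*1/suc≡1 d = ℚP.toℚᵘ-injective (ℚᵘP.≃-trans (ℚP.toℚᵘ-homo-* (ℕ→ℚ (suc d)) (+ 1 / suc d))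
   (ℚᵘP.≃-trans (ℚᵘP.*-cong (toℚᵘ-/suc (+ suc d) 0) (toℚᵘ-/suc (+ 1) d))
   (ℚᵘP.≃-trans step (ℚᵘP.≃-sym (toℚᵘ-/suc (+ 1) 0)))))
  where
  step : (ℚᵘ.mkℚᵘ (+ suc d) 0 ℚᵘ.* ℚᵘ.mkℚᵘ (+ 1) d) ℚᵘ.≃ ℚᵘ.mkℚᵘ (+ 1) 0
  step = ℚᵘ.*≡* (cong (λ z → +[1+ z ]) (ℕsolve 1 (λ d → d :* con 1 :* con 1 := d :+ con 0 :* (con 1 :+ d) :+ con 0 :* (con 1 :+ (d :+ con 0 :* (con 1 :+ d)))) refl d))
    where open NS.+-*-Solver renaming (solve to ℕsolve)

ℕ→ℚ-homo-+ : ∀ m n → ℕ→ℚ (m ℕ.+ n) ≡ ℕ→ℚ m + ℕ→ℚ n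
ℕ→ℚ-homo-+ m n = ℤ→ℚ-homo-+ (+ m) (+ n)

ℕ→ℚ-homo-* : ∀ m n → ℕ→ℚ (m ℕ.* n) ≡ ℕ→ℚ m * ℕ→ℚ n
ℕ→ℚ-homo-* m n = trans (cong ℤ→ℚ (ℤP.pos-* m n)) (ℤ→ℚ-homo-* (+ m) (+ n))

ℕ→ℚ-homo-∸ : ∀ m n → n ≤ m → ℕ→ℚ (m ∸ n) ≡ ℕ→ℚ m - ℕ→ℚ n
ℕ→ℚ-homo-∸ m n n≤m = begin
  ℕ→ℚ (m ∸ n) ≡⟨ QS.solve 2 (λ a b → a := (a :+ b) :- b) refl (ℕ→ℚ (m ∸ n)) (ℕ→ℚ n) ⟩
  (ℕ→ℚ (m ∸ n) + ℕ→ℚ n) - ℕ→ℚ n ≡⟨ cong (_- ℕ→ℚ n) (sym (ℕ→ℚ-homo-+ (m ∸ n) n)) ⟩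
  ℕ→ℚ (m ∸ n ℕ.+ n) - ℕ→ℚ n ≡⟨ cong (λ z → ℕ→ℚ z - ℕ→ℚ n) (ℕP.m∸n+n≡m n≤m) ⟩
  ℕ→ℚ m - ℕ→ℚ n ∎
  where open QS

n*1/n≡1 : ∀ d .{{_ : ℕ.NonZero d}} → ℕ→ℚ d * (+ 1 / d) ≡ 1ℚ
n*1/n≡1 (suc d) = suc*1/suc≡1 d

n!*invFact≡1 : ∀ m → ℕ→ℚ (m !) * invFact m ≡ 1ℚ
n!*invFact≡1 m = n*1/n≡1 (m !) {{m ℕP.!≢0}}

suc*-cancelˡ : ∀ n a b → ℕ→ℚ (suc n) * a ≡ ℕ→ℚ (suc n) * b → a ≡ b
suc*-cancelˡ n a b eq = begin
  a ≡⟨ sym (ℚP.*-identityˡ a) ⟩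
  1ℚ * a ≡⟨ cong (_* a) (sym (suc*1/suc≡1 n)) ⟩
  (ℕ→ℚ (suc n) * (+ 1 / suc n)) * a ≡⟨ QS.solve 3 (λ x y a → (x :* y) :* a := y :* (x :* a)) refl (ℕ→ℚ (suc n)) (+ 1 / suc n) a ⟩
  (+ 1 / suc n) * (ℕ→ℚ (suc n) * a) ≡⟨ cong ((+ 1 / suc n) *_) eq ⟩
  (+ 1 / suc n) * (ℕ→ℚ (suc n) * b) ≡⟨ QS.solve 3 (λ x y a → y :* (x :* a) := (x :* y) :* a) refl (ℕ→ℚ (suc n)) (+ 1 / suc n) b ⟩
  (ℕ→ℚ (suc n) * (+ 1 / suc n)) * b ≡⟨ cong (_* b) (suc*1/suc≡1 n) ⟩
  1ℚ * b ≡⟨ ℚP.*-identityˡ b ⟩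
  b ∎
  where open QS

ℤ→ℚ-homo-sub : ∀ x y → ℤ→ℚ (x ℤ.- y) ≡ ℤ→ℚ x - ℤ→ℚ y
ℤ→ℚ-homo-sub x y = trans (ℤ→ℚ-homo-+ x (ℤ.- y)) (cong (λ z → ℤ→ℚ x + z) (ℤ→ℚ-homo‿- y))

suc*invFact-suc≡invFact : ∀ a → ℕ→ℚ (suc a) * invFact (suc a) ≡ invFact a
suc*invFact-suc≡invFact a = begin
  ℕ→ℚ (suc a) * invFact (suc a) ≡⟨ sym (ℚP.*-identityˡ _) ⟩
  1ℚ * (ℕ→ℚ (suc a) * invFact (suc a)) ≡⟨ cong (_* (ℕ→ℚ (suc a) * invFact (suc a))) (sym (n!*invFact≡1 a)) ⟩
  (ℕ→ℚ (a !) * invFact a) * (ℕ→ℚ (suc a) * invFact (suc a)) ≡⟨ QS.solve 4 (λ A I' F I → (F :* I) :* (A :* I') := I :* ((A :* F) :* I')) refl (ℕ→ℚ (suc a)) (invFact (suc a)) (ℕ→ℚ (a !)) (invFact a) ⟩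
  invFact a * ((ℕ→ℚ (suc a) * ℕ→ℚ (a !)) * invFact (suc a)) ≡⟨ cong (λ z → invFact a * (z * invFact (suc a))) (sym (ℕ→ℚ-homo-* (suc a) (a !))) ⟩
  invFact a * (ℕ→ℚ (suc a !) * invFact (suc a)) ≡⟨ cong (invFact a *_) (n!*invFact≡1 (suc a)) ⟩
  invFact a * 1ℚ ≡⟨ ℚP.*-identityʳ _ ⟩
  invFact a ∎
  where open QS

x+y≡z⇒x≡z-y : ∀ {x y z} → x + y ≡ z → x ≡ z - y
x+y≡z⇒x≡z-y {x} {y} e = trans (QS.solve 2 (λ x y → x := (x :+ y) :- y) refl x y) (cong (_- y) e)
  where open QS

sumTo-cong≤ : ∀ n {f g : ℕ → ℚ} → (∀ i → i ≤ n → f i ≡ g i) → sumTo n f ≡ sumTo n g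
sumTo-cong≤ zero eq = eq 0 z≤n
sumTo-cong≤ (suc n) eq = cong₂ _+_ (sumTo-cong≤ n (λ i i≤n → eq i (ℕP.m≤n⇒m≤1+n i≤n))) (eq (suc n) ℕP.≤-refl)

sumTo-cong : ∀ n {f g : ℕ → ℚ} → (∀ i → f i ≡ g i) → sumTo n f ≡ sumTo n g
sumTo-cong n eq = sumTo-cong≤ n (λ i _ → eq i)

sumTo-+ : ∀ n (f g : ℕ → ℚ) → sumTo n (λ i → f i + g i) ≡ sumTo n f + sumTo n g
sumTo-+ zero f g = refl
sumTo-+ (suc n) f g = trans (cong (_+ (f (suc n) + g (suc n))) (sumTo-+ n f g))
  (QS.solve 4 (λ a b c d → (a :+ b) :+ (c :+ d) := (a :+ c) :+ (b :+ d)) refl (sumTo n f) (sumTo n g) (f (suc n)) (g (suc n)))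
  where open QS

sumTo-*ˡ : ∀ n c (f : ℕ → ℚ) → c * sumTo n f ≡ sumTo n (λ i → c * f i)
sumTo-*ˡ zero c f = refl
sumTo-*ˡ (suc n) c f = trans (ℚP.*-distribˡ-+ c (sumTo n f) (f (suc n))) (cong (_+ (c * f (suc n))) (sumTo-*ˡ n c f))

sumTo-*ʳ : ∀ n c (f : ℕ → ℚ) → sumTo n f * c ≡ sumTo n (λ i → f i * c)
sumTo-*ʳ n c f = trans (ℚP.*-comm (sumTo n f) c) (trans (sumTo-*ˡ n c f) (sumTo-cong n (λ i → ℚP.*-comm c (f i))))

sumTo-neg : ∀ n (f : ℕ → ℚ) → - sumTo n f ≡ sumTo n (λ i → - f i)
sumTo-neg zero f = refl
sumTo-neg (suc n) f = trans (ℚP.neg-distrib-+ (sumTo n f) (f (suc n))) (cong (_+ (- f (suc n))) (sumTo-neg n f))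

sumTo-≡0 : ∀ n (f : ℕ → ℚ) → (∀ i → i ≤ n → f i ≡ 0ℚ) → sumTo n f ≡ 0ℚ
sumTo-≡0 zero f eq = eq 0 z≤n
sumTo-≡0 (suc n) f eq = trans (cong₂ _+_ (sumTo-≡0 n f (λ i i≤n → eq i (ℕP.m≤n⇒m≤1+n i≤n))) (eq (suc n) ℕP.≤-refl)) refl

sumTo-suc : ∀ n (f : ℕ → ℚ) → sumTo (suc n) f ≡ f 0 + sumTo n (λ i → f (suc i))
sumTo-suc zero f = refl
sumTo-suc (suc n) f = trans (cong (_+ f (suc (suc n))) (sumTo-suc n f))
  (ℚP.+-assoc (f 0) (sumTo n (λ i → f (suc i))) (f (suc (suc n))))

sumTo-truncate : ∀ m n (f : ℕ → ℚ) → m ≤ n → (∀ i → m < i → i ≤ n → f i ≡ 0ℚ) → sumTo n f ≡ sumTo m f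
sumTo-truncate m n f m≤n eq = trans (cong (λ z → sumTo z f) (sym (ℕP.m+[n∸m]≡n m≤n)))
  (sumTo-ext m (n ∸ m) f (λ i m<i i≤ → eq i m<i (ℕP.≤-trans i≤ (ℕP.≤-reflexive (ℕP.m+[n∸m]≡n m≤n)))))
  where
  sumTo-ext : ∀ m k (f : ℕ → ℚ) → (∀ i → m < i → i ≤ m ℕ.+ k → f i ≡ 0ℚ) → sumTo (m ℕ.+ k) f ≡ sumTo m f
  sumTo-ext m zero f eq = cong (λ z → sumTo z f) (ℕP.+-identityʳ m)
  sumTo-ext m (suc k) f eq = begin
    sumTo (m ℕ.+ suc k) f ≡⟨ cong (λ z → sumTo z f) (ℕP.+-suc m k) ⟩
    sumTo (m ℕ.+ k) f + f (suc (m ℕ.+ k)) ≡⟨ cong₂ _+_ (sumTo-ext m k f (λ i m<i i≤ → eq i m<i (ℕP.≤-trans i≤ (ℕP.+-monoʳ-≤ m (ℕP.n≤1+n k)))))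
                                              (eq (suc (m ℕ.+ k)) (s≤s (ℕP.m≤m+n m k)) (ℕP.≤-reflexive (sym (ℕP.+-suc m k)))) ⟩
    sumTo m f + 0ℚ ≡⟨ ℚP.+-identityʳ _ ⟩
    sumTo m f ∎

sumTo-swap : ∀ n m (F : ℕ → ℕ → ℚ) → sumTo n (λ i → sumTo m (λ j → F i j)) ≡ sumTo m (λ j → sumTo n (λ i → F i j))
sumTo-swap zero m F = refl
sumTo-swap (suc n) m F = begin
  sumTo n (λ i → sumTo m (F i)) + sumTo m (F (suc n)) ≡⟨ cong (_+ sumTo m (F (suc n))) (sumTo-swap n m F) ⟩
  sumTo m (λ j → sumTo n (λ i → F i j)) + sumTo m (F (suc n)) ≡⟨ sym (sumTo-+ m _ _) ⟩
  sumTo m (λ j → sumTo (suc n) (λ i → F i j)) ∎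

sumTo-reverse : ∀ n (f : ℕ → ℚ) → sumTo n f ≡ sumTo n (λ i → f (n ∸ i))
sumTo-reverse zero f = refl
sumTo-reverse (suc n) f = begin
  sumTo n f + f (suc n) ≡⟨ ℚP.+-comm (sumTo n f) (f (suc n)) ⟩
  f (suc n) + sumTo n f ≡⟨ cong (λ z → f (suc n) + z) (sumTo-reverse n f) ⟩
  f (suc n) + sumTo n (λ i → f (n ∸ i)) ≡⟨ sym (sumTo-suc n (λ i → f (suc n ∸ i))) ⟩
  sumTo (suc n) (λ i → f (suc n ∸ i)) ∎

sumTo-triangle : ∀ n (F : ℕ → ℕ → ℚ) →
  sumTo n (λ i → sumTo i (λ j → F i j)) ≡ sumTo n (λ j → sumTo (n ∸ j) (λ l → F (l ℕ.+ j) j))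
sumTo-triangle zero F = refl
sumTo-triangle (suc n) F = begin
  sumTo n (λ i → sumTo i (F i)) + sumTo (suc n) (F (suc n))
    ≡⟨ cong (_+ sumTo (suc n) (F (suc n))) (sumTo-triangle n F) ⟩
  R n + (sumTo n (F (suc n)) + F (suc n) (suc n))
    ≡⟨ sym (ℚP.+-assoc (R n) _ _) ⟩
  (R n + sumTo n (F (suc n))) + F (suc n) (suc n)
    ≡⟨ cong (_+ F (suc n) (suc n)) (sym (sumTo-+ n _ _)) ⟩
  sumTo n (λ j → sumTo (n ∸ j) (λ l → F (l ℕ.+ j) j) + F (suc n) j) + F (suc n) (suc n)
    ≡⟨ cong₂ _+_ (sumTo-cong≤ n step) (cong (λ z → sumTo z (λ l → F (l ℕ.+ suc n) (suc n))) (sym (ℕP.n∸n≡0 n))) ⟩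
  sumTo n (λ j → sumTo (suc n ∸ j) (λ l → F (l ℕ.+ j) j)) + sumTo (n ∸ n) (λ l → F (l ℕ.+ suc n) (suc n)) ∎
  where
  R : ℕ → ℚ
  R n = sumTo n (λ j → sumTo (n ∸ j) (λ l → F (l ℕ.+ j) j))
  step : ∀ j → j ≤ n → sumTo (n ∸ j) (λ l → F (l ℕ.+ j) j) + F (suc n) j ≡ sumTo (suc n ∸ j) (λ l → F (l ℕ.+ j) j)
  step j j≤n = begin
    sumTo (n ∸ j) (λ l → F (l ℕ.+ j) j) + F (suc n) j
      ≡⟨ cong (λ z → sumTo (n ∸ j) (λ l → F (l ℕ.+ j) j) + F z j) (sym (cong suc (ℕP.m∸n+n≡m j≤n))) ⟩
    sumTo (suc (n ∸ j)) (λ l → F (l ℕ.+ j) j)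
      ≡⟨ cong (λ z → sumTo z (λ l → F (l ℕ.+ j) j)) (sym (ℕP.+-∸-assoc 1 j≤n)) ⟩
    sumTo (suc n ∸ j) (λ l → F (l ℕ.+ j) j) ∎

-- The ring of formal power series over ℚ

infix 4 _≈S_
record _≈S_ (f g : Series) : Set where
  constructor mk≈
  field app : ∀ n → f n ≡ g n
open _≈S_ public

≈S-refl : ∀ {f} → f ≈S f
≈S-refl = mk≈ λ n → refl
≈S-sym : ∀ {f g} → f ≈S g → g ≈S f
≈S-sym e = mk≈ λ n → sym (app e n)
≈S-trans : ∀ {f g h} → f ≈S g → g ≈S h → f ≈S h
≈S-trans e e' = mk≈ λ n → trans (app e n) (app e' n)

zeroS : Series
zeroS _ = 0ℚ

κ : ℚ → Series
κ c zero = c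
κ c (suc _) = 0ℚ

X : Series
X (suc zero) = 1ℚ
X _ = 0ℚ

⊛-cong : ∀ {f f' g g'} → f ≈S f' → g ≈S g' → f ⊛ g ≈S f' ⊛ g'
⊛-cong {f} {f'} {g} {g'} e e' = mk≈ λ n → sumTo-cong n (λ i → cong₂ _*_ (app e i) (app e' (n ∸ i)))

⊕-cong : ∀ {f f' g g'} → f ≈S f' → g ≈S g' → f ⊕ g ≈S f' ⊕ g'
⊕-cong e e' = mk≈ λ n → cong₂ _+_ (app e n) (app e' n)

neg-cong : ∀ {f f'} → f ≈S f' → negS f ≈S negS f'
neg-cong e = mk≈ λ n → cong -_ (app e n)

⊛-congˡ : ∀ {f f'} → f ≈S f' → ∀ g → f ⊛ g ≈S f' ⊛ g
⊛-congˡ e g = ⊛-cong e (≈S-refl {g})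
⊛-congʳ : ∀ f {g g'} → g ≈S g' → f ⊛ g ≈S f ⊛ g'
⊛-congʳ f e = ⊛-cong (≈S-refl {f}) e
⊕-congˡ : ∀ {f f'} → f ≈S f' → ∀ g → f ⊕ g ≈S f' ⊕ g
⊕-congˡ e g = ⊕-cong e (≈S-refl {g})
⊕-congʳ : ∀ f {g g'} → g ≈S g' → f ⊕ g ≈S f ⊕ g'
⊕-congʳ f e = ⊕-cong (≈S-refl {f}) e

⊛-localʳ : ∀ f F G n → (∀ k → k ≤ n → F k ≡ G k) → (f ⊛ F) n ≡ (f ⊛ G) n
⊛-localʳ f F G n e = sumTo-cong≤ n (λ i i≤n → cong (f i *_) (e (n ∸ i) (ℕP.m∸n≤m n i)))

⊛-comm : ∀ f g → f ⊛ g ≈S g ⊛ f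
⊛-comm f g = mk≈ λ n → begin
  sumTo n (λ i → f i * g (n ∸ i)) ≡⟨ sumTo-reverse n _ ⟩
  sumTo n (λ i → f (n ∸ i) * g (n ∸ (n ∸ i))) ≡⟨ sumTo-cong≤ n (λ i i≤n → trans (cong (λ z → f (n ∸ i) * g z) (ℕP.m∸[m∸n]≡n i≤n)) (ℚP.*-comm (f (n ∸ i)) (g i))) ⟩
  sumTo n (λ i → g i * f (n ∸ i)) ∎

⊛-assoc : ∀ f g h → (f ⊛ g) ⊛ h ≈S f ⊛ (g ⊛ h)
⊛-assoc f g h = mk≈ λ n → begin
  sumTo n (λ i → sumTo i (λ j → f j * g (i ∸ j)) * h (n ∸ i))
    ≡⟨ sumTo-cong n (λ i → sumTo-*ʳ i (h (n ∸ i)) (λ j → f j * g (i ∸ j))) ⟩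
  sumTo n (λ i → sumTo i (λ j → f j * g (i ∸ j) * h (n ∸ i)))
    ≡⟨ sumTo-triangle n (λ i j → f j * g (i ∸ j) * h (n ∸ i)) ⟩
  sumTo n (λ j → sumTo (n ∸ j) (λ l → f j * g (l ℕ.+ j ∸ j) * h (n ∸ (l ℕ.+ j))))
    ≡⟨ sumTo-cong n (λ j → trans (sumTo-cong (n ∸ j) (λ l → 
         trans (cong₂ (λ a b → f j * g a * h b) (ℕP.m+n∸n≡m l j) (trans (cong (n ∸_) (ℕP.+-comm l j)) (sym (ℕP.∸-+-assoc n j l))))
               (ℚP.*-assoc (f j) (g l) (h (n ∸ j ∸ l)))))
         (sym (sumTo-*ˡ (n ∸ j) (f j) (λ l → g l * h (n ∸ j ∸ l))))) ⟩
  sumTo n (λ j → f j * sumTo (n ∸ j) (λ l → g l * h (n ∸ j ∸ l))) ∎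

⊛-distribˡ : ∀ f g h → f ⊛ (g ⊕ h) ≈S (f ⊛ g) ⊕ (f ⊛ h)
⊛-distribˡ f g h = mk≈ λ n → trans (sumTo-cong n (λ i → ℚP.*-distribˡ-+ (f i) (g (n ∸ i)) (h (n ∸ i)))) (sumTo-+ n (λ i → f i * g (n ∸ i)) (λ i → f i * h (n ∸ i)))

⊛-distribʳ : ∀ f g h → (g ⊕ h) ⊛ f ≈S (g ⊛ f) ⊕ (h ⊛ f)
⊛-distribʳ f g h = mk≈ λ n → trans (sumTo-cong n (λ i → ℚP.*-distribʳ-+ (f (n ∸ i)) (g i) (h i))) (sumTo-+ n (λ i → g i * f (n ∸ i)) (λ i → h i * f (n ∸ i)))

⊛-identityˡ : ∀ f → oneS ⊛ f ≈S f
⊛-identityˡ f = mk≈ (aux f)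
  where
  aux : ∀ f n → (oneS ⊛ f) n ≡ f n
  aux f zero = ℚP.*-identityˡ _
  aux f (suc n) = begin
    sumTo (suc n) (λ i → oneS i * f (suc n ∸ i)) ≡⟨ sumTo-suc n _ ⟩
    1ℚ * f (suc n) + sumTo n (λ i → 0ℚ * f (n ∸ i)) ≡⟨ cong₂ _+_ (ℚP.*-identityˡ (f (suc n))) (sumTo-≡0 n (λ i → 0ℚ * f (n ∸ i)) (λ i _ → ℚP.*-zeroˡ (f (n ∸ i)))) ⟩
    f (suc n) + 0ℚ ≡⟨ ℚP.+-identityʳ _ ⟩
    f (suc n) ∎

⊛-identityʳ : ∀ f → f ⊛ oneS ≈S f
⊛-identityʳ f = ≈S-trans (⊛-comm f oneS) (⊛-identityˡ f)

Series-commutativeRing : CommutativeRing 0ℓ 0ℓ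
Series-commutativeRing = record
  { Carrier = Series ; _≈_ = _≈S_ ; _+_ = _⊕_ ; _*_ = _⊛_ ; -_ = negS ; 0# = zeroS ; 1# = oneS
  ; isCommutativeRing = record
    { isRing = record
      { +-isAbelianGroup = record
        { isGroup = record
          { isMonoid = record
            { isSemigroup = record
              { isMagma = record { isEquivalence = record { refl = ≈S-refl ; sym = ≈S-sym ; trans = ≈S-trans } ; ∙-cong = ⊕-cong }
              ; assoc = λ f g h → mk≈ λ n → ℚP.+-assoc (f n) (g n) (h n) }
            ; identity = (λ f → mk≈ λ n → ℚP.+-identityˡ (f n)) , (λ f → mk≈ λ n → ℚP.+-identityʳ (f n)) }
          ; inverse = (λ f → mk≈ λ n → ℚP.+-inverseˡ (f n)) , (λ f → mk≈ λ n → ℚP.+-inverseʳ (f n))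
          ; ⁻¹-cong = neg-cong }
        ; comm = λ f g → mk≈ λ n → ℚP.+-comm (f n) (g n) }
      ; *-cong = ⊛-cong
      ; *-assoc = ⊛-assoc
      ; *-identity = ⊛-identityˡ , ⊛-identityʳ
      ; distrib = ⊛-distribˡ , ⊛-distribʳ }
    ; *-comm = ⊛-comm } }

Series-almostCommutativeRing : AlmostCommutativeRing 0ℓ 0ℓ
Series-almostCommutativeRing = fromCommutativeRing Series-commutativeRing

κ-⊛ : ∀ a b → κ (a * b) ≈S κ a ⊛ κ b
κ-⊛ a b = mk≈ λ { zero → refl ; (suc n) → sym (sumTo-≡0 (suc n) _ λ { zero _ → ℚP.*-zeroʳ a ; (suc i) _ → ℚP.*-zeroˡ (κ b (suc n ∸ suc i)) }) }

κ-⊕ : ∀ a b → κ (a + b) ≈S κ a ⊕ κ b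
κ-⊕ a b = mk≈ λ { zero → refl ; (suc n) → refl }

κ-neg : ∀ a → κ (- a) ≈S negS (κ a)
κ-neg a = mk≈ λ { zero → refl ; (suc n) → refl }

κ-homomorphism : ℚP.+-*-rawRing -Raw-AlmostCommutative⟶ Series-almostCommutativeRing
κ-homomorphism = record { ⟦_⟧ = κ ; +-homo = κ-⊕ ; *-homo = κ-⊛ ; -‿homo = κ-neg ; 0-homo = mk≈ λ { zero → refl ; (suc n) → refl } ; 1-homo = mk≈ λ { zero → refl ; (suc n) → refl } }

κ-≈? : ∀ a b → Maybe (κ a ≈S κ b)
κ-≈? a b with a ℚP.≟ b
... | yes refl = just ≈S-refl
... | no _ = nothing

module SeriesSolver = RingSolver ℚP.+-*-rawRing Series-almostCommutativeRing κ-homomorphism κ-≈?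

infixr 2 _≈⟨_⟩_
infix 3 _∎S
_≈⟨_⟩_ : ∀ f {g h} → f ≈S g → g ≈S h → f ≈S h
f ≈⟨ p ⟩ q = ≈S-trans p q
_∎S : ∀ f → f ≈S f
f ∎S = ≈S-refl

-- θ = t·d/dt
θ : Series → Series
θ f n = ℕ→ℚ n * f n

θ-⊛ : ∀ f g → θ (f ⊛ g) ≈S (θ f ⊛ g) ⊕ (f ⊛ θ g)
θ-⊛ f g = mk≈ λ n → θ-⊛ₚ f g n
  where
  θ-⊛ₚ : ∀ f g n → θ (f ⊛ g) n ≡ ((θ f ⊛ g) ⊕ (f ⊛ θ g)) n
  θ-⊛ₚ f g n = begin
    ℕ→ℚ n * sumTo n (λ i → f i * g (n ∸ i)) ≡⟨ sumTo-*ˡ n (ℕ→ℚ n) _ ⟩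
    sumTo n (λ i → ℕ→ℚ n * (f i * g (n ∸ i))) ≡⟨ sumTo-cong≤ n step ⟩
    sumTo n (λ i → ℕ→ℚ i * f i * g (n ∸ i) + f i * (ℕ→ℚ (n ∸ i) * g (n ∸ i))) ≡⟨ sumTo-+ n _ _ ⟩
    (θ f ⊛ g) n + (f ⊛ θ g) n ∎
    where
    step : ∀ i → i ≤ n → ℕ→ℚ n * (f i * g (n ∸ i)) ≡ ℕ→ℚ i * f i * g (n ∸ i) + f i * (ℕ→ℚ (n ∸ i) * g (n ∸ i))
    step i i≤n = begin
      ℕ→ℚ n * (f i * g (n ∸ i)) ≡⟨ cong (λ z → ℕ→ℚ z * (f i * g (n ∸ i))) (sym (ℕP.m+[n∸m]≡n i≤n)) ⟩
      ℕ→ℚ (i ℕ.+ (n ∸ i)) * (f i * g (n ∸ i)) ≡⟨ cong (_* (f i * g (n ∸ i))) (ℕ→ℚ-homo-+ i (n ∸ i)) ⟩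
      (ℕ→ℚ i + ℕ→ℚ (n ∸ i)) * (f i * g (n ∸ i)) ≡⟨ QS.solve 4 (λ a b x y → (a :+ b) :* (x :* y) := a :* x :* y :+ x :* (b :* y)) refl (ℕ→ℚ i) (ℕ→ℚ (n ∸ i)) (f i) (g (n ∸ i)) ⟩
      ℕ→ℚ i * f i * g (n ∸ i) + f i * (ℕ→ℚ (n ∸ i) * g (n ∸ i)) ∎
      where open QS

θ-cong : ∀ {f g} → f ≈S g → θ f ≈S θ g
θ-cong e = mk≈ λ n → cong (ℕ→ℚ n *_) (app e n)

θ-κ : ∀ c → θ (κ c) ≈S zeroS
θ-κ c = mk≈ λ { zero → ℚP.*-zeroˡ c ; (suc n) → ℚP.*-zeroʳ (ℕ→ℚ (suc n)) }

oneS≈κ1 : oneS ≈S κ 1ℚ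
oneS≈κ1 = mk≈ λ { zero → refl ; (suc n) → refl }

zeroS≈κ0 : zeroS ≈S κ 0ℚ
zeroS≈κ0 = mk≈ λ { zero → refl ; (suc n) → refl }

θ-one : θ oneS ≈S zeroS
θ-one = ≈S-trans (θ-cong oneS≈κ1) (θ-κ 1ℚ)

θ-pow : ∀ f m → θ (powS f (suc m)) ≈S κ (ℕ→ℚ (suc m)) ⊛ (powS f m ⊛ θ f)
θ-pow f zero = θ (f ⊛ oneS) ≈⟨ θ-⊛ f oneS ⟩
  (θ f ⊛ oneS) ⊕ (f ⊛ θ oneS) ≈⟨ ⊕-cong (⊛-congʳ (θ f) oneS≈κ1) (⊛-congʳ f (≈S-trans θ-one zeroS≈κ0)) ⟩
  (θ f ⊛ κ 1ℚ) ⊕ (f ⊛ κ 0ℚ) ≈⟨ SeriesSolver.solve 2 (λ a b → (a :* con 1ℚ) :+ (b :* con 0ℚ) := con 1ℚ :* (con 1ℚ :* a)) ≈S-refl (θ f) f ⟩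
  κ 1ℚ ⊛ (κ 1ℚ ⊛ θ f) ≈⟨ ⊛-congʳ (κ 1ℚ) (⊛-congˡ (≈S-sym oneS≈κ1) (θ f)) ⟩
  κ (ℕ→ℚ 1) ⊛ (oneS ⊛ θ f) ∎S
  where open SeriesSolver
θ-pow f (suc m) =
  θ (f ⊛ powS f (suc m)) ≈⟨ θ-⊛ f (powS f (suc m)) ⟩
  (θ f ⊛ powS f (suc m)) ⊕ (f ⊛ θ (powS f (suc m))) ≈⟨ ⊕-congʳ (θ f ⊛ powS f (suc m)) (⊛-congʳ f (θ-pow f m)) ⟩
  (θ f ⊛ (f ⊛ powS f m)) ⊕ (f ⊛ (κ (ℕ→ℚ (suc m)) ⊛ (powS f m ⊛ θ f)))
    ≈⟨ SeriesSolver.solve 4 (λ d f p k → (d :* (f :* p)) :+ (f :* (k :* (p :* d))) := (k :+ con 1ℚ) :* ((f :* p) :* d)) ≈S-refl (θ f) f (powS f m) (κ (ℕ→ℚ (suc m))) ⟩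
  (κ (ℕ→ℚ (suc m)) ⊕ κ 1ℚ) ⊛ ((f ⊛ powS f m) ⊛ θ f) ≈⟨ ⊛-congˡ (≈S-trans (≈S-sym (κ-⊕ _ _)) (mk≈ λ n → cong (λ z → κ z n) (trans (ℚP.+-comm (ℕ→ℚ (suc m)) 1ℚ) (sym (ℕ→ℚ-homo-+ 1 (suc m)))))) ((f ⊛ powS f m) ⊛ θ f) ⟩
  κ (ℕ→ℚ (suc (suc m))) ⊛ (powS f (suc m) ⊛ θ f) ∎S
  where open SeriesSolver

powS-cong : ∀ {f g} → f ≈S g → ∀ m → powS f m ≈S powS g m
powS-cong e zero = ≈S-refl
powS-cong e (suc m) = ⊛-cong e (powS-cong e m)

powS-+ : ∀ f m n → powS f (m ℕ.+ n) ≈S powS f m ⊛ powS f n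
powS-+ f zero n = ≈S-sym (⊛-identityˡ (powS f n))
powS-+ f (suc m) n = powS f (suc m ℕ.+ n) ≈⟨ ⊛-congʳ f (powS-+ f m n) ⟩
  f ⊛ (powS f m ⊛ powS f n) ≈⟨ ≈S-sym (⊛-assoc f (powS f m) (powS f n)) ⟩
  powS f (suc m) ⊛ powS f n ∎S

powS-⊛ : ∀ f g m → powS (f ⊛ g) m ≈S powS f m ⊛ powS g m
powS-⊛ f g zero = ≈S-sym (⊛-identityˡ oneS)
powS-⊛ f g (suc m) = (f ⊛ g) ⊛ powS (f ⊛ g) m ≈⟨ ⊛-congʳ (f ⊛ g) (powS-⊛ f g m) ⟩
  (f ⊛ g) ⊛ (powS f m ⊛ powS g m) ≈⟨ SeriesSolver.solve 4 (λ f g p q → (f :* g) :* (p :* q) := (f :* p) :* (g :* q)) ≈S-refl f g (powS f m) (powS g m) ⟩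
  (f ⊛ powS f m) ⊛ (g ⊛ powS g m) ∎S
  where open SeriesSolver

powS-vanishes-below : ∀ g → g 0 ≡ 0ℚ → ∀ m n → n < m → powS g m n ≡ 0ℚ
powS-vanishes-below g g0 (suc m) n n<m = sumTo-≡0 n _ term
  where
  term : ∀ i → i ≤ n → g i * powS g m (n ∸ i) ≡ 0ℚ
  term zero _ = trans (cong (_* powS g m n) g0) (ℚP.*-zeroˡ (powS g m n))
  term (suc i) i≤n = trans (cong (g (suc i) *_) (powS-vanishes-below g g0 m (n ∸ suc i) lt)) (ℚP.*-zeroʳ (g (suc i)))
    where
    lt' : ∀ n → n < suc m → suc i ≤ n → n ∸ suc i < m
    lt' (suc n') p _ = ℕP.≤-<-trans (ℕP.m∸n≤m n' i) (ℕP.≤-pred p)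
    lt : n ∸ suc i < m
    lt = lt' n n<m i≤n

X⊛-suc : ∀ f n → (X ⊛ f) (suc n) ≡ f n
X⊛-suc f n = begin
  sumTo (suc n) (λ i → X i * f (suc n ∸ i)) ≡⟨ sumTo-suc n _ ⟩
  0ℚ * f (suc n) + sumTo n (λ i → X (suc i) * f (n ∸ i)) ≡⟨ cong₂ _+_ (ℚP.*-zeroˡ (f (suc n))) (inner n) ⟩
  0ℚ + f n ≡⟨ ℚP.+-identityˡ (f n) ⟩
  f n ∎
  where
  inner : ∀ n → sumTo n (λ i → X (suc i) * f (n ∸ i)) ≡ f n
  inner zero = ℚP.*-identityˡ (f 0)
  inner (suc n) = begin
    sumTo (suc n) (λ i → X (suc i) * f (suc n ∸ i)) ≡⟨ sumTo-suc n _ ⟩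
    1ℚ * f (suc n) + sumTo n (λ i → 0ℚ * f (n ∸ i)) ≡⟨ cong₂ _+_ (ℚP.*-identityˡ (f (suc n))) (sumTo-≡0 n _ (λ i _ → ℚP.*-zeroˡ (f (n ∸ i)))) ⟩
    f (suc n) + 0ℚ ≡⟨ ℚP.+-identityʳ _ ⟩
    f (suc n) ∎

X-zero : ∀ f → (X ⊛ f) 0 ≡ 0ℚ
X-zero f = ℚP.*-zeroˡ (f 0)

X⊛-cancel : ∀ {f g} → X ⊛ f ≈S X ⊛ g → f ≈S g
X⊛-cancel {f} {g} e = mk≈ λ n → trans (sym (X⊛-suc f n)) (trans (app e (suc n)) (X⊛-suc g n))

geometricSum : Series → ℕ → Series
geometricSum h zero = κ 1ℚ
geometricSum h (suc N) = geometricSum h N ⊕ powS h (suc N)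

geometricSum-coeff : ∀ h N n → geometricSum h N n ≡ sumTo N (λ m → powS h m n)
geometricSum-coeff h zero n = sym (app oneS≈κ1 n)
geometricSum-coeff h (suc N) n = cong (_+ powS h (suc N) n) (geometricSum-coeff h N n)

1-h⊛geometricSum : ∀ h N → (κ 1ℚ ⊕ negS h) ⊛ geometricSum h N ≈S κ 1ℚ ⊕ negS (powS h (suc N))
1-h⊛geometricSum h zero = (κ 1ℚ ⊕ negS h) ⊛ κ 1ℚ ≈⟨ SeriesSolver.solve 1 (λ h → (con 1ℚ :- h) :* con 1ℚ := con 1ℚ :- h :* con 1ℚ) ≈S-refl h ⟩
   κ 1ℚ ⊕ negS (h ⊛ κ 1ℚ) ≈⟨ ⊕-congʳ (κ 1ℚ) (neg-cong (⊛-congʳ h (≈S-sym oneS≈κ1))) ⟩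
   κ 1ℚ ⊕ negS (h ⊛ oneS) ∎S
  where open SeriesSolver
1-h⊛geometricSum h (suc N) = (κ 1ℚ ⊕ negS h) ⊛ (geometricSum h N ⊕ powS h (suc N))
    ≈⟨ ⊛-distribˡ (κ 1ℚ ⊕ negS h) (geometricSum h N) (powS h (suc N)) ⟩
  ((κ 1ℚ ⊕ negS h) ⊛ geometricSum h N) ⊕ ((κ 1ℚ ⊕ negS h) ⊛ powS h (suc N))
    ≈⟨ ⊕-congˡ (1-h⊛geometricSum h N) ((κ 1ℚ ⊕ negS h) ⊛ powS h (suc N)) ⟩
  (κ 1ℚ ⊕ negS (h ⊛ powS h N)) ⊕ ((κ 1ℚ ⊕ negS h) ⊛ (h ⊛ powS h N))
    ≈⟨ SeriesSolver.solve 2 (λ h p → (con 1ℚ :- h :* p) :+ ((con 1ℚ :- h) :* (h :* p)) := con 1ℚ :- h :* (h :* p)) ≈S-refl h (powS h N) ⟩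
  κ 1ℚ ⊕ negS (h ⊛ (h ⊛ powS h N)) ∎S
  where open SeriesSolver

⊛-invS : ∀ f → f 0 ≡ 1ℚ → f ⊛ invS f ≈S oneS
⊛-invS f f0 = mk≈ λ n → begin
  (f ⊛ invS f) n ≡⟨ ⊛-localʳ f (invS f) (geometricSum h n) n (loc n) ⟩
  (f ⊛ geometricSum h n) n ≡⟨ app (⊛-congˡ f≈ (geometricSum h n)) n ⟩
  ((κ 1ℚ ⊕ negS h) ⊛ geometricSum h n) n ≡⟨ app (1-h⊛geometricSum h n) n ⟩
  κ 1ℚ n + - powS h (suc n) n ≡⟨ cong (λ z → κ 1ℚ n + - z) (powS-vanishes-below h h0 (suc n) n ℕP.≤-refl) ⟩
  κ 1ℚ n + - 0ℚ ≡⟨ ℚP.+-identityʳ (κ 1ℚ n) ⟩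
  κ 1ℚ n ≡⟨ sym (app oneS≈κ1 n) ⟩
  oneS n ∎
  where
  h : Series
  h = oneS ⊕ negS f
  h0 : h 0 ≡ 0ℚ
  h0 = trans (cong (λ z → 1ℚ + - z) f0) refl
  f≈ : f ≈S κ 1ℚ ⊕ negS h
  f≈ = mk≈ λ k → trans (QS.solve 2 (λ a b → a := b :- (b :- a)) refl (f k) (oneS k)) (cong (_- h k) (app oneS≈κ1 k))
    where open QS
  loc : ∀ n k → k ≤ n → invS f k ≡ geometricSum h n k
  loc n k k≤n = begin
    sumTo k (λ m → 1ℚ * powS h m k) ≡⟨ sumTo-cong k (λ m → ℚP.*-identityˡ _) ⟩
    sumTo k (λ m → powS h m k) ≡⟨ sym (sumTo-truncate k n (λ m → powS h m k) k≤n (λ m k<m _ → powS-vanishes-below h h0 m k k<m)) ⟩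
    sumTo n (λ m → powS h m k) ≡⟨ sym (geometricSum-coeff h n k) ⟩
    geometricSum h n k ∎

sumTo-*-sumTo : ∀ N M (f g : ℕ → ℚ) → sumTo N f * sumTo M g ≡ sumTo N (λ m → sumTo M (λ m' → f m * g m'))
sumTo-*-sumTo N M f g = trans (sumTo-*ʳ N (sumTo M g) f) (sumTo-cong N (λ m → sumTo-*ˡ M (f m) g))

subst-truncation : ∀ c g → g 0 ≡ 0ℚ → ∀ n N → n ≤ N → subst c g n ≡ sumTo N (λ m → c m * powS g m n)
subst-truncation c g g0 n N n≤N = sym (sumTo-truncate n N _ n≤N (λ m n<m _ → trans (cong (c m *_) (powS-vanishes-below g g0 m n n<m)) (ℚP.*-zeroʳ (c m))))

subst-cong : ∀ {c d} → c ≈S d → ∀ g → subst c g ≈S subst d g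
subst-cong e g = mk≈ λ n → sumTo-cong n (λ m → cong (_* powS g m n) (app e m))

subst-homo-⊛ : ∀ c d g → g 0 ≡ 0ℚ → subst c g ⊛ subst d g ≈S subst (c ⊛ d) g
subst-homo-⊛ c d g g0 = mk≈ pt
  where
  pt : ∀ n → (subst c g ⊛ subst d g) n ≡ subst (c ⊛ d) g n
  pt n = begin
    sumTo n (λ i → subst c g i * subst d g (n ∸ i))
      ≡⟨ sumTo-cong≤ n (λ i i≤n → cong₂ _*_ (subst-truncation c g g0 i n i≤n) (subst-truncation d g g0 (n ∸ i) n (ℕP.m∸n≤m n i))) ⟩
    sumTo n (λ i → sumTo n (λ m → c m * powS g m i) * sumTo n (λ m' → d m' * powS g m' (n ∸ i)))
      ≡⟨ sumTo-cong n (λ i → sumTo-*-sumTo n n (λ m → c m * powS g m i) (λ m' → d m' * powS g m' (n ∸ i))) ⟩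
    sumTo n (λ i → sumTo n (λ m → sumTo n (λ m' → (c m * powS g m i) * (d m' * powS g m' (n ∸ i)))))
      ≡⟨ sumTo-swap n n _ ⟩
    sumTo n (λ m → sumTo n (λ i → sumTo n (λ m' → (c m * powS g m i) * (d m' * powS g m' (n ∸ i)))))
      ≡⟨ sumTo-cong n (λ m → sumTo-swap n n _) ⟩
    sumTo n (λ m → sumTo n (λ m' → sumTo n (λ i → (c m * powS g m i) * (d m' * powS g m' (n ∸ i)))))
      ≡⟨ sumTo-cong n (λ m → sumTo-cong n (λ m' → inner m m')) ⟩
    sumTo n (λ m → sumTo n (λ m' → c m * d m' * powS g (m ℕ.+ m') n))
      ≡⟨ sumTo-cong≤ n (λ m m≤n → sumTo-truncate (n ∸ m) n _ (ℕP.m∸n≤m n m) (λ m' lt _ → van m m' lt)) ⟩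
    sumTo n (λ m → sumTo (n ∸ m) (λ m' → c m * d m' * powS g (m ℕ.+ m') n))
      ≡⟨ sumTo-cong n (λ m → sumTo-cong (n ∸ m) (λ l → cong₂ (λ a b → c m * d a * powS g b n) (sym (ℕP.m+n∸n≡m l m)) (ℕP.+-comm m l))) ⟩
    sumTo n (λ m → sumTo (n ∸ m) (λ l → c m * d (l ℕ.+ m ∸ m) * powS g (l ℕ.+ m) n))
      ≡⟨ sym (sumTo-triangle n (λ s m → c m * d (s ∸ m) * powS g s n)) ⟩
    sumTo n (λ s → sumTo s (λ m → c m * d (s ∸ m) * powS g s n))
      ≡⟨ sumTo-cong n (λ s → sym (sumTo-*ʳ s (powS g s n) (λ m → c m * d (s ∸ m)))) ⟩
    subst (c ⊛ d) g n ∎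
    where
    inner : ∀ m m' → sumTo n (λ i → (c m * powS g m i) * (d m' * powS g m' (n ∸ i))) ≡ c m * d m' * powS g (m ℕ.+ m') n
    inner m m' = begin
      sumTo n (λ i → (c m * powS g m i) * (d m' * powS g m' (n ∸ i)))
        ≡⟨ sumTo-cong n (λ i → QS.solve 4 (λ a b x y → (a :* x) :* (b :* y) := (a :* b) :* (x :* y)) refl (c m) (d m') (powS g m i) (powS g m' (n ∸ i))) ⟩
      sumTo n (λ i → (c m * d m') * (powS g m i * powS g m' (n ∸ i)))
        ≡⟨ sym (sumTo-*ˡ n (c m * d m') _) ⟩
      (c m * d m') * (powS g m ⊛ powS g m') n
        ≡⟨ cong (c m * d m' *_) (sym (app (powS-+ g m m') n)) ⟩
      c m * d m' * powS g (m ℕ.+ m') n ∎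
      where open QS
    van : ∀ m m' → n ∸ m < m' → c m * d m' * powS g (m ℕ.+ m') n ≡ 0ℚ
    van m m' lt = trans (cong (c m * d m' *_) (powS-vanishes-below g g0 (m ℕ.+ m') n lt')) (ℚP.*-zeroʳ (c m * d m'))
      where
      lt' : n < m ℕ.+ m'
      lt' = ℕP.≤-trans (ℕP.≤-trans (s≤s (ℕP.m≤n+m∸n n m)) (ℕP.≤-reflexive (sym (ℕP.+-suc m (n ∸ m))))) (ℕP.+-monoʳ-≤ m lt)

sumTo-oneS* : ∀ n (F : ℕ → ℚ) → sumTo n (λ i → oneS i * F i) ≡ F 0
sumTo-oneS* zero F = ℚP.*-identityˡ (F 0)
sumTo-oneS* (suc n) F = begin
  sumTo (suc n) (λ i → oneS i * F i) ≡⟨ sumTo-suc n _ ⟩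
  1ℚ * F 0 + sumTo n (λ i → 0ℚ * F (suc i)) ≡⟨ cong₂ _+_ (ℚP.*-identityˡ (F 0)) (sumTo-≡0 n _ (λ i _ → ℚP.*-zeroˡ (F (suc i)))) ⟩
  F 0 + 0ℚ ≡⟨ ℚP.+-identityʳ (F 0) ⟩
  F 0 ∎

sumTo-X* : ∀ n (F : ℕ → ℚ) → sumTo (suc n) (λ i → X i * F i) ≡ F 1
sumTo-X* n F = begin
  sumTo (suc n) (λ i → X i * F i) ≡⟨ sumTo-suc n _ ⟩
  0ℚ * F 0 + sumTo n (λ i → X (suc i) * F (suc i)) ≡⟨ cong₂ _+_ (ℚP.*-zeroˡ (F 0)) (trans (sumTo-cong n (λ i → cong (_* F (suc i)) (XS i))) (sumTo-oneS* n (λ i → F (suc i)))) ⟩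
  0ℚ + F 1 ≡⟨ ℚP.+-identityˡ (F 1) ⟩
  F 1 ∎
  where
  XS : ∀ i → X (suc i) ≡ oneS i
  XS zero = refl
  XS (suc i) = refl

κ⊛-coeff : ∀ c F n → (κ c ⊛ F) n ≡ c * F n
κ⊛-coeff c F zero = refl
κ⊛-coeff c F (suc n) = begin
  sumTo (suc n) (λ i → κ c i * F (suc n ∸ i)) ≡⟨ sumTo-suc n _ ⟩
  c * F (suc n) + sumTo n (λ i → 0ℚ * F (n ∸ i)) ≡⟨ cong (λ z → c * F (suc n) + z) (sumTo-≡0 n _ (λ i _ → ℚP.*-zeroˡ (F (n ∸ i)))) ⟩
  c * F (suc n) + 0ℚ ≡⟨ ℚP.+-identityʳ _ ⟩
  c * F (suc n) ∎

subst-homo-one : ∀ g → subst oneS g ≈S oneS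
subst-homo-one g = mk≈ λ n → sumTo-oneS* n (λ m → powS g m n)

subst-X : ∀ g → g 0 ≡ 0ℚ → subst X g ≈S g
subst-X g g0 = mk≈ λ { zero → trans (ℚP.*-zeroˡ 1ℚ) (sym g0) ; (suc n) → trans (sumTo-X* n (λ m → powS g m (suc n))) (app (⊛-identityʳ g) (suc n)) }

subst-homo-⊕ : ∀ c d g → subst (c ⊕ d) g ≈S subst c g ⊕ subst d g
subst-homo-⊕ c d g = mk≈ λ n → trans (sumTo-cong n (λ m → ℚP.*-distribʳ-+ (powS g m n) (c m) (d m))) (sumTo-+ n (λ m → c m * powS g m n) (λ m → d m * powS g m n))

subst-homo-neg : ∀ c g → subst (negS c) g ≈S negS (subst c g)
subst-homo-neg c g = mk≈ λ n → trans (sumTo-cong n (λ m → sym (ℚP.neg-distribˡ-* (c m) (powS g m n)))) (sym (sumTo-neg n (λ m → c m * powS g m n)))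

subst-homo-powS : ∀ c g → g 0 ≡ 0ℚ → ∀ r → subst (powS c r) g ≈S powS (subst c g) r
subst-homo-powS c g g0 zero = subst-homo-one g
subst-homo-powS c g g0 (suc r) = ≈S-trans (≈S-sym (subst-homo-⊛ c (powS c r) g g0)) (⊛-congʳ (subst c g) (subst-homo-powS c g g0 r))

-- log(1+t), its powers and the Stirling numbers of the first kind

onePlusT≈1+X : onePlusT ≈S oneS ⊕ X
onePlusT≈1+X = mk≈ λ { zero → refl ; (suc zero) → refl ; (suc (suc n)) → refl }

onePlusT⊛-suc : ∀ F n → (onePlusT ⊛ F) (suc n) ≡ F (suc n) + F n
onePlusT⊛-suc F n = begin
  (onePlusT ⊛ F) (suc n) ≡⟨ app (⊛-congˡ onePlusT≈1+X F) (suc n) ⟩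
  ((oneS ⊕ X) ⊛ F) (suc n) ≡⟨ app (⊛-distribʳ F oneS X) (suc n) ⟩
  (oneS ⊛ F) (suc n) + (X ⊛ F) (suc n) ≡⟨ cong₂ _+_ (app (⊛-identityˡ F) (suc n)) (X⊛-suc F n) ⟩
  F (suc n) + F n ∎

minus1 : ℚ
minus1 = - 1ℚ

θ-log1p-suc : ∀ m → θ log1p (suc m) ≡ minus1 ^ℚ m
θ-log1p-suc m = begin
  ℕ→ℚ (suc m) * ((minus1 ^ℚ m) * (+ 1 / suc m)) ≡⟨ QS.solve 3 (λ a b c → a :* (b :* c) := b :* (a :* c)) refl (ℕ→ℚ (suc m)) (minus1 ^ℚ m) (+ 1 / suc m) ⟩
  (minus1 ^ℚ m) * (ℕ→ℚ (suc m) * (+ 1 / suc m)) ≡⟨ cong ((minus1 ^ℚ m) *_) (suc*1/suc≡1 m) ⟩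
  (minus1 ^ℚ m) * 1ℚ ≡⟨ ℚP.*-identityʳ _ ⟩
  minus1 ^ℚ m ∎
  where open QS

onePlusT⊛θ-log1p≈X : onePlusT ⊛ θ log1p ≈S X
onePlusT⊛θ-log1p≈X = mk≈ λ { zero → refl ; (suc zero) → trans (onePlusT⊛-suc (θ log1p) 0) (trans (cong (_+ θ log1p 0) (θ-log1p-suc 0)) refl)
  ; (suc (suc n)) → trans (onePlusT⊛-suc (θ log1p) (suc n)) (trans (cong₂ _+_ (θ-log1p-suc (suc n)) (θ-log1p-suc n))
       (cancelm1 (minus1 ^ℚ n))) }
  where
  cancelm1 : ∀ p → minus1 * p + p ≡ 0ℚ
  cancelm1 = QS.solve 1 (λ p → (con minus1 :* p) :+ p := con 0ℚ) refl
    where open QS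

logPow : ℕ → ℕ → ℚ
logPow a m = powS log1p m a

-- Both [t^a] log(1+t)^m and m! S₁(a,m)/a! satisfy this recurrence: for the former it is the
-- coefficient of t^(a+1) in (1+t)·θ(log(1+t)^(m+1)) = (m+1)·t·log(1+t)^m.
StirlingRecurrence : (ℕ → ℕ → ℚ) → Set
StirlingRecurrence u = ∀ a m → ℕ→ℚ (suc a) * u (suc a) (suc m) + ℕ→ℚ a * u a (suc m) ≡ ℕ→ℚ (suc m) * u a m

logPow-recurrence : StirlingRecurrence logPow
logPow-recurrence a m = begin
  ℕ→ℚ (suc a) * logPow (suc a) (suc m) + ℕ→ℚ a * logPow a (suc m) ≡⟨ sym (onePlusT⊛-suc (θ (powS log1p (suc m))) a) ⟩
  (onePlusT ⊛ θ (powS log1p (suc m))) (suc a) ≡⟨ app eq (suc a) ⟩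
  (κ (ℕ→ℚ (suc m)) ⊛ (powS log1p m ⊛ X)) (suc a) ≡⟨ κ⊛-coeff (ℕ→ℚ (suc m)) (powS log1p m ⊛ X) (suc a) ⟩
  ℕ→ℚ (suc m) * (powS log1p m ⊛ X) (suc a) ≡⟨ cong (ℕ→ℚ (suc m) *_) (trans (app (⊛-comm (powS log1p m) X) (suc a)) (X⊛-suc (powS log1p m) a)) ⟩
  ℕ→ℚ (suc m) * logPow a m ∎
  where
  eq : onePlusT ⊛ θ (powS log1p (suc m)) ≈S κ (ℕ→ℚ (suc m)) ⊛ (powS log1p m ⊛ X)
  eq = onePlusT ⊛ θ (powS log1p (suc m)) ≈⟨ ⊛-congʳ onePlusT (θ-pow log1p m) ⟩
       onePlusT ⊛ (κ (ℕ→ℚ (suc m)) ⊛ (powS log1p m ⊛ θ log1p))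
         ≈⟨ SeriesSolver.solve 4 (λ o k p t → o :* (k :* (p :* t)) := k :* (p :* (o :* t))) ≈S-refl onePlusT (κ (ℕ→ℚ (suc m))) (powS log1p m) (θ log1p) ⟩
       κ (ℕ→ℚ (suc m)) ⊛ (powS log1p m ⊛ (onePlusT ⊛ θ log1p)) ≈⟨ ⊛-congʳ (κ (ℕ→ℚ (suc m))) (⊛-congʳ (powS log1p m) onePlusT⊛θ-log1p≈X) ⟩
       κ (ℕ→ℚ (suc m)) ⊛ (powS log1p m ⊛ X) ∎S
       where open SeriesSolver

stirlingCoeff : ℕ → ℕ → ℚ
stirlingCoeff a m = ℕ→ℚ (m !) * ℤ→ℚ (stirling1 a m) * invFact a

stirlingCoeff-recurrence : StirlingRecurrence stirlingCoeff
stirlingCoeff-recurrence a m = begin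
  A * (ℕ→ℚ (suc m !) * ℤ→ℚ (stirling1 (suc a) (suc m)) * I') + N * (ℕ→ℚ (suc m !) * s1 * I)
    ≡⟨ cong₂ (λ z w → A * (z * w * I') + N * (z * s1 * I)) (ℕ→ℚ-homo-* (suc m) (m !))
         (trans (ℤ→ℚ-homo-sub (stirling1 a m) (+ a ℤ.* stirling1 a (suc m))) (cong (λ z → s0 - z) (ℤ→ℚ-homo-* (+ a) (stirling1 a (suc m))))) ⟩
  A * (M * F * (s0 - N * s1) * I') + N * (M * F * s1 * I)
    ≡⟨ QS.solve 8 (λ A I' I F M N s0 s1 → A :* (M :* F :* (s0 :- N :* s1) :* I') :+ N :* (M :* F :* s1 :* I)
                   := (A :* I') :* (M :* F :* (s0 :- N :* s1)) :+ N :* (M :* F :* s1 :* I)) refl A I' I F M N s0 s1 ⟩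
  (A * I') * (M * F * (s0 - N * s1)) + N * (M * F * s1 * I)
    ≡⟨ cong (λ z → z * (M * F * (s0 - N * s1)) + N * (M * F * s1 * I)) (suc*invFact-suc≡invFact a) ⟩
  I * (M * F * (s0 - N * s1)) + N * (M * F * s1 * I)
    ≡⟨ QS.solve 8 (λ A I' I F M N s0 s1 → I :* (M :* F :* (s0 :- N :* s1)) :+ N :* (M :* F :* s1 :* I)
                   := M :* (F :* s0 :* I)) refl A I' I F M N s0 s1 ⟩
  M * stirlingCoeff a m ∎
  where
  open QS
  A I' I F M N s0 s1 : ℚ
  A = ℕ→ℚ (suc a)
  I' = invFact (suc a)
  I = invFact a
  F = ℕ→ℚ (m !)
  M = ℕ→ℚ (suc m)
  N = ℕ→ℚ a
  s0 = ℤ→ℚ (stirling1 a m)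
  s1 = ℤ→ℚ (stirling1 a (suc m))

stirling1-suc-zero : ∀ a → stirling1 (suc a) 0 ≡ + 0
stirling1-suc-zero zero = refl
stirling1-suc-zero (suc a) = trans (cong (λ z → ℤ.- (+ suc a ℤ.* z)) (stirling1-suc-zero a)) (cong ℤ.-_ (ℤP.*-zeroʳ (+ suc a)))

stirling1-above : ∀ m k → m < k → stirling1 m k ≡ + 0
stirling1-above zero (suc k) _ = refl
stirling1-above (suc m) (suc k) (s≤s m<k) = trans (cong₂ (λ x y → x ℤ.- (+ m ℤ.* y)) (stirling1-above m k m<k) (stirling1-above m (suc k) (ℕP.m≤n⇒m≤1+n m<k)))
  (cong (λ z → + 0 ℤ.- z) (ℤP.*-zeroʳ (+ m)))

stirlingRecurrence-unique : ∀ u v → StirlingRecurrence u → StirlingRecurrence v → (∀ m → u 0 m ≡ v 0 m) → (∀ a → u (suc a) 0 ≡ v (suc a) 0) → ∀ a m → u a m ≡ v a m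
stirlingRecurrence-unique u v ru rv b0 bs zero m = b0 m
stirlingRecurrence-unique u v ru rv b0 bs (suc a) zero = bs a
stirlingRecurrence-unique u v ru rv b0 bs (suc a) (suc m) = suc*-cancelˡ a _ _ (begin
  ℕ→ℚ (suc a) * u (suc a) (suc m) ≡⟨ x+y≡z⇒x≡z-y (ru a m) ⟩
  ℕ→ℚ (suc m) * u a m - ℕ→ℚ a * u a (suc m) ≡⟨ cong₂ (λ x y → ℕ→ℚ (suc m) * x - ℕ→ℚ a * y) (stirlingRecurrence-unique u v ru rv b0 bs a m) (stirlingRecurrence-unique u v ru rv b0 bs a (suc m)) ⟩
  ℕ→ℚ (suc m) * v a m - ℕ→ℚ a * v a (suc m) ≡⟨ sym (x+y≡z⇒x≡z-y (rv a m)) ⟩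
  ℕ→ℚ (suc a) * v (suc a) (suc m) ∎)

logPow≡stirlingCoeff : ∀ a m → logPow a m ≡ stirlingCoeff a m
logPow≡stirlingCoeff = stirlingRecurrence-unique logPow stirlingCoeff logPow-recurrence stirlingCoeff-recurrence b0 bs
  where
  b0 : ∀ m → logPow 0 m ≡ stirlingCoeff 0 m
  b0 zero = refl
  b0 (suc m) = trans (powS-vanishes-below log1p refl (suc m) 0 (s≤s z≤n)) (sym (QS.solve 2 (λ a b → a :* con 0ℚ :* b := con 0ℚ) refl (ℕ→ℚ (suc m !)) (invFact 0)))
    where open QS
  bs : ∀ a → logPow (suc a) 0 ≡ stirlingCoeff (suc a) 0
  bs a = sym (trans (cong (λ z → ℕ→ℚ 1 * ℤ→ℚ z * invFact (suc a)) (stirling1-suc-zero a)) (QS.solve 1 (λ b → con 1ℚ :* con 0ℚ :* b := con 0ℚ) refl (invFact (suc a))))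
    where open QS

1^ℚ≡1 : ∀ k → 1ℚ ^ℚ k ≡ 1ℚ
1^ℚ≡1 zero = refl
1^ℚ≡1 (suc k) = trans (ℚP.*-identityˡ (1ℚ ^ℚ k)) (1^ℚ≡1 k)

onePlusTPow-coef : ∀ x m → onePlusTPow x m ≡ sumTo m (λ j → (x ^ℚ j) * ℤ→ℚ (stirling1 m j)) * invFact m
onePlusTPow-coef x m = begin
  sumTo m (λ j → ((x ^ℚ j) * invFact j) * powS log1p j m) ≡⟨ sumTo-cong m (λ j → cong (((x ^ℚ j) * invFact j) *_) (logPow≡stirlingCoeff m j)) ⟩
  sumTo m (λ j → ((x ^ℚ j) * invFact j) * (ℕ→ℚ (j !) * ℤ→ℚ (stirling1 m j) * invFact m)) ≡⟨ sumTo-cong m (λ j → step j) ⟩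
  sumTo m (λ j → (x ^ℚ j) * ℤ→ℚ (stirling1 m j) * invFact m) ≡⟨ sym (sumTo-*ʳ m (invFact m) _) ⟩
  sumTo m (λ j → (x ^ℚ j) * ℤ→ℚ (stirling1 m j)) * invFact m ∎
  where
  step : ∀ j → ((x ^ℚ j) * invFact j) * (ℕ→ℚ (j !) * ℤ→ℚ (stirling1 m j) * invFact m) ≡ (x ^ℚ j) * ℤ→ℚ (stirling1 m j) * invFact m
  step j = begin
    ((x ^ℚ j) * invFact j) * (ℕ→ℚ (j !) * ℤ→ℚ (stirling1 m j) * invFact m) ≡⟨ QS.solve 5 (λ a b c d e → (a :* b) :* (c :* d :* e) := (c :* b) :* (a :* d :* e)) refl (x ^ℚ j) (invFact j) (ℕ→ℚ (j !)) (ℤ→ℚ (stirling1 m j)) (invFact m) ⟩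
    (ℕ→ℚ (j !) * invFact j) * ((x ^ℚ j) * ℤ→ℚ (stirling1 m j) * invFact m) ≡⟨ cong (_* ((x ^ℚ j) * ℤ→ℚ (stirling1 m j) * invFact m)) (n!*invFact≡1 j) ⟩
    1ℚ * ((x ^ℚ j) * ℤ→ℚ (stirling1 m j) * invFact m) ≡⟨ ℚP.*-identityˡ _ ⟩
    (x ^ℚ j) * ℤ→ℚ (stirling1 m j) * invFact m ∎
    where open QS

stirling1RowSum : ℕ → ℚ
stirling1RowSum m = sumTo m (λ j → ℤ→ℚ (stirling1 m j))

stirling1RowSum-suc : ∀ m → stirling1RowSum (suc m) ≡ (1ℚ - ℕ→ℚ m) * stirling1RowSum m
stirling1RowSum-suc m = begin
  stirling1RowSum (suc m) ≡⟨ sumTo-suc m _ ⟩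
  ℤ→ℚ (stirling1 (suc m) 0) + sumTo m (λ j → ℤ→ℚ (stirling1 (suc m) (suc j)))
    ≡⟨ cong₂ _+_ (trans (ℤ→ℚ-homo‿- (+ m ℤ.* stirling1 m 0)) (cong -_ (ℤ→ℚ-homo-* (+ m) (stirling1 m 0))))
                 (sumTo-cong m (λ j → trans (ℤ→ℚ-homo-sub (stirling1 m j) (+ m ℤ.* stirling1 m (suc j))) (cong (λ z → s j - z) (ℤ→ℚ-homo-* (+ m) (stirling1 m (suc j)))))) ⟩
  - (M * s 0) + sumTo m (λ j → s j - M * s (suc j))
    ≡⟨ cong (λ z → - (M * s 0) + z) (trans (sumTo-+ m s _) (cong (λ z → stirling1RowSum m + z) (trans (sym (sumTo-neg m _)) (cong -_ (sym (sumTo-*ˡ m M _)))))) ⟩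
  - (M * s 0) + (stirling1RowSum m + - (M * sumTo m (λ j → s (suc j))))
    ≡⟨ cong (λ z → - (M * s 0) + (stirling1RowSum m + - (M * z))) tail ⟩
  - (M * s 0) + (stirling1RowSum m + - (M * (stirling1RowSum m - s 0)))
    ≡⟨ QS.solve 3 (λ M s0 q → (:- (M :* s0)) :+ (q :+ (:- (M :* (q :- s0)))) := (con 1ℚ :- M) :* q) refl M (s 0) (stirling1RowSum m) ⟩
  (1ℚ - M) * stirling1RowSum m ∎
  where
  open QS
  M : ℚ
  M = ℕ→ℚ m
  s : ℕ → ℚ
  s j = ℤ→ℚ (stirling1 m j)
  tail : sumTo m (λ j → s (suc j)) ≡ stirling1RowSum m - s 0
  tail = begin
    sumTo m (λ j → s (suc j)) ≡⟨ QS.solve 2 (λ a b → a := (b :+ a) :- b) refl _ (s 0) ⟩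
    (s 0 + sumTo m (λ j → s (suc j))) - s 0 ≡⟨ cong (_- s 0) (sym (sumTo-suc m s)) ⟩
    (stirling1RowSum m + s (suc m)) - s 0 ≡⟨ cong (λ z → (stirling1RowSum m + ℤ→ℚ z) - s 0) (stirling1-above m (suc m) ℕP.≤-refl) ⟩
    (stirling1RowSum m + 0ℚ) - s 0 ≡⟨ cong (_- s 0) (ℚP.+-identityʳ (stirling1RowSum m)) ⟩
    stirling1RowSum m - s 0 ∎

stirling1RowSum-vanishes : ∀ n → stirling1RowSum (suc (suc n)) ≡ 0ℚ
stirling1RowSum-vanishes zero = trans (stirling1RowSum-suc 1) (trans (cong ((1ℚ - ℕ→ℚ 1) *_) (stirling1RowSum-suc 0)) refl)
stirling1RowSum-vanishes (suc n) = trans (stirling1RowSum-suc (suc (suc n))) (trans (cong ((1ℚ - ℕ→ℚ (suc (suc n))) *_) (stirling1RowSum-vanishes n)) (ℚP.*-zeroʳ (1ℚ - ℕ→ℚ (suc (suc n)))))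

onePlusTPow-1 : onePlusTPow 1ℚ ≈S onePlusT
onePlusTPow-1 = mk≈ λ m → trans (onePlusTPow-coef 1ℚ m) (trans (cong (_* invFact m) (sumTo-cong m (λ j → trans (cong (_* ℤ→ℚ (stirling1 m j)) (1^ℚ≡1 j)) (ℚP.*-identityˡ _)))) (fin m))
  where
  fin : ∀ m → stirling1RowSum m * invFact m ≡ onePlusT m
  fin zero = refl
  fin (suc zero) = trans (cong (_* invFact 1) (stirling1RowSum-suc 0)) refl
  fin (suc (suc n)) = trans (cong (_* invFact (suc (suc n))) (stirling1RowSum-vanishes n)) (ℚP.*-zeroˡ (invFact (suc (suc n))))

expXT-θ : ∀ x → θ (expXT x) ≈S κ x ⊛ (X ⊛ expXT x)
expXT-θ x = mk≈ pt
  where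
  pt : ∀ n → θ (expXT x) n ≡ (κ x ⊛ (X ⊛ expXT x)) n
  pt zero = sym (trans (κ⊛-coeff x (X ⊛ expXT x) 0) (trans (cong (x *_) (X-zero (expXT x))) (ℚP.*-zeroʳ x)))
  pt (suc n) = begin
    ℕ→ℚ (suc n) * ((x * (x ^ℚ n)) * invFact (suc n)) ≡⟨ QS.solve 4 (λ a b c d → a :* ((b :* c) :* d) := b :* (c :* (a :* d))) refl (ℕ→ℚ (suc n)) x (x ^ℚ n) (invFact (suc n)) ⟩
    x * ((x ^ℚ n) * (ℕ→ℚ (suc n) * invFact (suc n))) ≡⟨ cong (λ z → x * ((x ^ℚ n) * z)) (suc*invFact-suc≡invFact n) ⟩
    x * expXT x n ≡⟨ cong (x *_) (sym (X⊛-suc (expXT x) n)) ⟩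
    x * (X ⊛ expXT x) (suc n) ≡⟨ sym (κ⊛-coeff x (X ⊛ expXT x) (suc n)) ⟩
    (κ x ⊛ (X ⊛ expXT x)) (suc n) ∎
    where open QS

θ-ode-unique : ∀ A F G → A 0 ≡ 0ℚ → θ F ≈S A ⊛ F → θ G ≈S A ⊛ G → F 0 ≡ G 0 → F ≈S G
θ-ode-unique A F G A0 eF eG e0 = mk≈ λ n → P n n ℕP.≤-refl
  where
  shift : ∀ H n → (A ⊛ H) (suc n) ≡ sumTo n (λ i → A (suc i) * H (n ∸ i))
  shift H n = trans (sumTo-suc n _) (trans (cong (_+ sumTo n (λ i → A (suc i) * H (n ∸ i))) (trans (cong (_* H (suc n)) A0) (ℚP.*-zeroˡ (H (suc n))))) (ℚP.+-identityˡ _))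
  P : ∀ n k → k ≤ n → F k ≡ G k
  P zero zero _ = e0
  P zero (suc k) ()
  P (suc n) k k≤ with k ℕP.≤? n
  ... | yes k≤n = P n k k≤n
  ... | no k≰n = trans (cong F keq) (trans step (cong G (sym keq)))
    where
    keq : k ≡ suc n
    keq = ℕP.≤-antisym k≤ (ℕP.≰⇒> k≰n)
    step : F (suc n) ≡ G (suc n)
    step = suc*-cancelˡ n _ _ (begin
      ℕ→ℚ (suc n) * F (suc n) ≡⟨ app eF (suc n) ⟩
      (A ⊛ F) (suc n) ≡⟨ shift F n ⟩
      sumTo n (λ i → A (suc i) * F (n ∸ i)) ≡⟨ sumTo-cong n (λ i → cong (A (suc i) *_) (P n (n ∸ i) (ℕP.m∸n≤m n i))) ⟩
      sumTo n (λ i → A (suc i) * G (n ∸ i)) ≡⟨ sym (shift G n) ⟩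
      (A ⊛ G) (suc n) ≡⟨ sym (app eG (suc n)) ⟩
      ℕ→ℚ (suc n) * G (suc n) ∎)

κ⊛X-zero : ∀ c → (κ c ⊛ X) 0 ≡ 0ℚ
κ⊛X-zero c = ℚP.*-zeroʳ c

expXT-+ : ∀ x y → expXT x ⊛ expXT y ≈S expXT (x + y)
expXT-+ x y = θ-ode-unique (κ (x + y) ⊛ X) (expXT x ⊛ expXT y) (expXT (x + y)) (κ⊛X-zero (x + y)) eF eG refl
  where
  eF : θ (expXT x ⊛ expXT y) ≈S (κ (x + y) ⊛ X) ⊛ (expXT x ⊛ expXT y)
  eF = θ (expXT x ⊛ expXT y) ≈⟨ θ-⊛ (expXT x) (expXT y) ⟩
       (θ (expXT x) ⊛ expXT y) ⊕ (expXT x ⊛ θ (expXT y)) ≈⟨ ⊕-cong (⊛-congˡ (expXT-θ x) (expXT y)) (⊛-congʳ (expXT x) (expXT-θ y)) ⟩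
       ((κ x ⊛ (X ⊛ expXT x)) ⊛ expXT y) ⊕ (expXT x ⊛ (κ y ⊛ (X ⊛ expXT y)))
         ≈⟨ SeriesSolver.solve 5 (λ a b X e f → ((a :* (X :* e)) :* f) :+ (e :* (b :* (X :* f))) := ((a :+ b) :* X) :* (e :* f)) ≈S-refl (κ x) (κ y) X (expXT x) (expXT y) ⟩
       ((κ x ⊕ κ y) ⊛ X) ⊛ (expXT x ⊛ expXT y) ≈⟨ ⊛-congˡ (⊛-congˡ (≈S-sym (κ-⊕ x y)) X) (expXT x ⊛ expXT y) ⟩
       (κ (x + y) ⊛ X) ⊛ (expXT x ⊛ expXT y) ∎S
    where open SeriesSolver
  eG : θ (expXT (x + y)) ≈S (κ (x + y) ⊛ X) ⊛ expXT (x + y)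
  eG = ≈S-trans (expXT-θ (x + y)) (≈S-sym (⊛-assoc (κ (x + y)) X (expXT (x + y))))

expXT-cong : ∀ {x y} → x ≡ y → expXT x ≈S expXT y
expXT-cong refl = ≈S-refl

expXT-0 : expXT 0ℚ ≈S oneS
expXT-0 = mk≈ λ { zero → refl ; (suc n) → trans (cong (_* invFact (suc n)) (ℚP.*-zeroˡ (0ℚ ^ℚ n))) (ℚP.*-zeroˡ (invFact (suc n))) }

powS-expXT : ∀ x r → powS (expXT x) r ≈S expXT (ℕ→ℚ r * x)
powS-expXT x zero = ≈S-sym (≈S-trans (expXT-cong (ℚP.*-zeroˡ x)) expXT-0)
powS-expXT x (suc r) = expXT x ⊛ powS (expXT x) r ≈⟨ ⊛-congʳ (expXT x) (powS-expXT x r) ⟩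
  expXT x ⊛ expXT (ℕ→ℚ r * x) ≈⟨ expXT-+ x (ℕ→ℚ r * x) ⟩
  expXT (x + ℕ→ℚ r * x) ≈⟨ expXT-cong (trans (QS.solve 2 (λ x r → x :+ r :* x := (con 1ℚ :+ r) :* x) refl x (ℕ→ℚ r)) (cong (_* x) (sym (ℕ→ℚ-homo-+ 1 r)))) ⟩
  expXT (ℕ→ℚ (suc r) * x) ∎S
  where open QS

-- t/((1+t) log(1+t)) as a series in log(1+t)

em E1 Em1 W QL V : Series
em = expm1OverT
E1 = expXT 1ℚ
Em1 = expXT minus1
W = em ⊛ Em1
QL = onePlusT ⊛ log1pOverT
V = subst W log1p

X⊛expm1OverT : X ⊛ em ≈S E1 ⊕ negS oneS
X⊛expm1OverT = mk≈ λ { zero → refl ; (suc n) → trans (X⊛-suc em n) (sym (trans (ℚP.+-identityʳ _) (trans (cong (_* invFact (suc n)) (trans (ℚP.*-identityˡ _) (1^ℚ≡1 n))) (ℚP.*-identityˡ _)))) }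

X⊛log1pOverT : X ⊛ log1pOverT ≈S log1p
X⊛log1pOverT = mk≈ λ { zero → refl ; (suc n) → X⊛-suc log1pOverT n }

onePlusT-1≈X : onePlusT ⊕ negS oneS ≈S X
onePlusT-1≈X = mk≈ λ { zero → refl ; (suc zero) → refl ; (suc (suc n)) → refl }

W⊛E1X : W ⊛ (E1 ⊛ X) ≈S E1 ⊕ negS oneS
W⊛E1X = W ⊛ (E1 ⊛ X) ≈⟨ SeriesSolver.solve 4 (λ a b c X → (a :* b) :* (c :* X) := (X :* a) :* (b :* c)) ≈S-refl em Em1 E1 X ⟩
  (X ⊛ em) ⊛ (Em1 ⊛ E1) ≈⟨ ⊛-cong X⊛expm1OverT (≈S-trans (expXT-+ minus1 1ℚ) expXT-0) ⟩
  (E1 ⊕ negS oneS) ⊛ oneS ≈⟨ ⊛-identityʳ _ ⟩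
  E1 ⊕ negS oneS ∎S
  where open SeriesSolver

V⊛QL≈1 : V ⊛ QL ≈S oneS
V⊛QL≈1 = X⊛-cancel (
  X ⊛ (V ⊛ QL) ≈⟨ SeriesSolver.solve 4 (λ X v o l → X :* (v :* (o :* l)) := v :* (o :* (X :* l))) ≈S-refl X V onePlusT log1pOverT ⟩
  V ⊛ (onePlusT ⊛ (X ⊛ log1pOverT)) ≈⟨ ⊛-congʳ V (⊛-cong (≈S-sym onePlusTPow-1) (≈S-trans X⊛log1pOverT (≈S-sym (subst-X log1p refl)))) ⟩
  V ⊛ (subst E1 log1p ⊛ subst X log1p) ≈⟨ ⊛-congʳ V (subst-homo-⊛ E1 X log1p refl) ⟩
  V ⊛ subst (E1 ⊛ X) log1p ≈⟨ subst-homo-⊛ W (E1 ⊛ X) log1p refl ⟩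
  subst (W ⊛ (E1 ⊛ X)) log1p ≈⟨ subst-cong W⊛E1X log1p ⟩
  subst (E1 ⊕ negS oneS) log1p ≈⟨ ≈S-trans (subst-homo-⊕ E1 (negS oneS) log1p) (⊕-congʳ (subst E1 log1p) (subst-homo-neg oneS log1p)) ⟩
  subst E1 log1p ⊕ negS (subst oneS log1p) ≈⟨ ⊕-cong onePlusTPow-1 (neg-cong (subst-homo-one log1p)) ⟩
  onePlusT ⊕ negS oneS ≈⟨ onePlusT-1≈X ⟩
  X ≈⟨ ≈S-sym (⊛-identityʳ X) ⟩
  X ⊛ oneS ∎S)
  where open SeriesSolver

tOverOnePlusTLog≈V : tOverOnePlusTLog ≈S V
tOverOnePlusTLog≈V = ≈S-sym (
  V ≈⟨ ≈S-sym (⊛-identityʳ V) ⟩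
  V ⊛ oneS ≈⟨ ⊛-congʳ V (≈S-sym (⊛-invS QL refl)) ⟩
  V ⊛ (QL ⊛ tOverOnePlusTLog) ≈⟨ ≈S-sym (⊛-assoc V QL tOverOnePlusTLog) ⟩
  (V ⊛ QL) ⊛ tOverOnePlusTLog ≈⟨ ⊛-congˡ V⊛QL≈1 tOverOnePlusTLog ⟩
  oneS ⊛ tOverOnePlusTLog ≈⟨ ⊛-identityˡ _ ⟩
  tOverOnePlusTLog ∎S)

powS-tOverOnePlusTLog : ∀ r → powS tOverOnePlusTLog r ≈S subst (powS W r) log1p
powS-tOverOnePlusTLog r = ≈S-trans (powS-cong tOverOnePlusTLog≈V r) (≈S-sym (subst-homo-powS W log1p refl r))

-- Lagrange inversion for log(1+t)

T : Series
T = tOverExpm1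

expm1OverT⊛T≈1 : em ⊛ T ≈S κ 1ℚ
expm1OverT⊛T≈1 = ≈S-trans (⊛-invS em refl) oneS≈κ1

θ-expm1OverT : θ em ≈S E1 ⊕ negS em
θ-expm1OverT = mk≈ λ n → begin
  ℕ→ℚ n * invFact (suc n) ≡⟨ QS.solve 3 (λ N I' I → N :* I' := (I :- I') :+ ((con 1ℚ :+ N) :* I' :- I)) refl (ℕ→ℚ n) (invFact (suc n)) (invFact n) ⟩
  (invFact n - invFact (suc n)) + ((1ℚ + ℕ→ℚ n) * invFact (suc n) - invFact n) ≡⟨ cong (λ z → (invFact n - invFact (suc n)) + (z * invFact (suc n) - invFact n)) (sym (ℕ→ℚ-homo-+ 1 n)) ⟩
  (invFact n - invFact (suc n)) + (ℕ→ℚ (suc n) * invFact (suc n) - invFact n) ≡⟨ cong (λ z → (invFact n - invFact (suc n)) + (z - invFact n)) (suc*invFact-suc≡invFact n) ⟩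
  (invFact n - invFact (suc n)) + (invFact n - invFact n) ≡⟨ QS.solve 2 (λ I I' → (I :- I') :+ (I :- I) := I :- I') refl (invFact n) (invFact (suc n)) ⟩
  invFact n - invFact (suc n) ≡⟨ cong (_- invFact (suc n)) (sym (trans (cong (_* invFact n) (1^ℚ≡1 n)) (ℚP.*-identityˡ (invFact n)))) ⟩
  (E1 ⊕ negS em) n ∎
  where open QS

θ-E1 : θ E1 ≈S X ⊛ E1
θ-E1 = ≈S-trans (expXT-θ 1ℚ) (≈S-trans (⊛-congˡ (≈S-sym oneS≈κ1) (X ⊛ E1)) (⊛-identityˡ (X ⊛ E1)))

θ-T : θ T ≈S T ⊕ negS ((T ⊛ T) ⊛ E1)
θ-T = θ T ≈⟨ SeriesSolver.solve 1 (λ t → t := t :* con 1ℚ) ≈S-refl (θ T) ⟩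
  θ T ⊛ κ 1ℚ ≈⟨ ⊛-congʳ (θ T) (≈S-sym expm1OverT⊛T≈1) ⟩
  θ T ⊛ (em ⊛ T) ≈⟨ SeriesSolver.solve 4 (λ d e t u → d :* (e :* t) := (((u :* t) :+ (e :* d)) :- (u :* t)) :* t) ≈S-refl (θ T) em T (θ em) ⟩
  (((θ em ⊛ T) ⊕ (em ⊛ θ T)) ⊕ negS (θ em ⊛ T)) ⊛ T ≈⟨ ⊛-congˡ (⊕-cong leibniz (neg-cong (⊛-congˡ θ-expm1OverT T))) T ⟩
  (κ 0ℚ ⊕ negS ((E1 ⊕ negS em) ⊛ T)) ⊛ T ≈⟨ SeriesSolver.solve 3 (λ t e m → (con 0ℚ :- ((e :- m) :* t)) :* t := ((m :* t) :* t) :- ((t :* t) :* e)) ≈S-refl T E1 em ⟩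
  ((em ⊛ T) ⊛ T) ⊕ negS ((T ⊛ T) ⊛ E1) ≈⟨ ⊕-congˡ (⊛-congˡ expm1OverT⊛T≈1 T) (negS ((T ⊛ T) ⊛ E1)) ⟩
  (κ 1ℚ ⊛ T) ⊕ negS ((T ⊛ T) ⊛ E1) ≈⟨ SeriesSolver.solve 2 (λ t e → (con 1ℚ :* t) :- ((t :* t) :* e) := t :- ((t :* t) :* e)) ≈S-refl T E1 ⟩
  T ⊕ negS ((T ⊛ T) ⊛ E1) ∎S
  where
  open SeriesSolver
  leibniz : (θ em ⊛ T) ⊕ (em ⊛ θ T) ≈S κ 0ℚ
  leibniz = ≈S-trans (≈S-sym (θ-⊛ em T)) (≈S-trans (θ-cong expm1OverT⊛T≈1) (≈S-trans (θ-κ 1ℚ) zeroS≈κ0))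

T⊛E1≈X+T : T ⊛ E1 ≈S X ⊕ T
T⊛E1≈X+T = T ⊛ E1 ≈⟨ SeriesSolver.solve 2 (λ t e → t :* e := ((e :- con 1ℚ) :* t) :+ t) ≈S-refl T E1 ⟩
  ((E1 ⊕ negS (κ 1ℚ)) ⊛ T) ⊕ T ≈⟨ ⊕-congˡ (⊛-congˡ (≈S-trans (⊕-congʳ E1 (neg-cong (≈S-sym oneS≈κ1))) (≈S-sym X⊛expm1OverT)) T) T ⟩
  ((X ⊛ em) ⊛ T) ⊕ T ≈⟨ ⊕-congˡ (≈S-trans (⊛-assoc X em T) (⊛-congʳ X expm1OverT⊛T≈1)) T ⟩
  (X ⊛ κ 1ℚ) ⊕ T ≈⟨ SeriesSolver.solve 2 (λ x t → (x :* con 1ℚ) :+ t := x :+ t) ≈S-refl X T ⟩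
  X ⊕ T ∎S
  where open SeriesSolver

kernel : ℕ → Series
kernel a = powS T (suc a) ⊛ E1

κ-suc : ∀ a → κ (ℕ→ℚ (suc a)) ≈S κ (ℕ→ℚ a) ⊕ κ 1ℚ
κ-suc a = ≈S-trans (mk≈ λ n → cong (λ z → κ z n) (trans (ℕ→ℚ-homo-+ 1 a) (ℚP.+-comm 1ℚ (ℕ→ℚ a)))) (κ-⊕ (ℕ→ℚ a) 1ℚ)

-- Uses θT = T - T²e^u and T e^u = u + T for T = u/(e^u - 1).
kernel-suc : ∀ a → κ (ℕ→ℚ (suc a)) ⊛ kernel (suc a) ≈S ((κ (ℕ→ℚ (suc a)) ⊛ kernel a) ⊕ negS (θ (kernel a))) ⊕ negS (κ (ℕ→ℚ a) ⊛ (X ⊛ kernel a))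
kernel-suc a =
  K ⊛ ((T ⊛ (T ⊛ Pa)) ⊛ E1) ≈⟨ ⊛-congˡ (κ-suc a) ((T ⊛ (T ⊛ Pa)) ⊛ E1) ⟩
  K1 ⊛ ((T ⊛ (T ⊛ Pa)) ⊛ E1)
    ≈⟨ SeriesSolver.solve 5 (λ k t p e x → (k :+ con 1ℚ) :* ((t :* (t :* p)) :* e) := ((k :+ con 1ℚ) :* ((t :* p) :* e)) :* ((x :+ t) :- x)) ≈S-refl K' T Pa E1 X ⟩
  (K1 ⊛ ((T ⊛ Pa) ⊛ E1)) ⊛ ((X ⊕ T) ⊕ negS X) ≈⟨ ⊛-congʳ (K1 ⊛ ((T ⊛ Pa) ⊛ E1)) (⊕-congˡ (≈S-sym T⊛E1≈X+T) (negS X)) ⟩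
  (K1 ⊛ ((T ⊛ Pa) ⊛ E1)) ⊛ ((T ⊛ E1) ⊕ negS X)
    ≈⟨ SeriesSolver.solve 5 (λ k t p e x → ((k :+ con 1ℚ) :* ((t :* p) :* e)) :* ((t :* e) :- x)
         := (((k :+ con 1ℚ) :* ((t :* p) :* e)) :- (((((k :+ con 1ℚ) :* (p :* (t :- ((t :* t) :* e)))) :* e) :+ ((t :* p) :* (x :* e))))) :- (k :* (x :* ((t :* p) :* e)))) ≈S-refl K' T Pa E1 X ⟩
  ((K1 ⊛ kernel a) ⊕ negS θexpr) ⊕ negS (K' ⊛ (X ⊛ kernel a)) ≈⟨ ⊕-congˡ (⊕-cong (⊛-congˡ (≈S-sym (κ-suc a)) (kernel a)) (neg-cong (≈S-sym θG))) (negS (K' ⊛ (X ⊛ kernel a))) ⟩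
  ((K ⊛ kernel a) ⊕ negS (θ (kernel a))) ⊕ negS (K' ⊛ (X ⊛ kernel a)) ∎S
  where
  open SeriesSolver
  K K' K1 Pa θexpr : Series
  K = κ (ℕ→ℚ (suc a))
  K' = κ (ℕ→ℚ a)
  K1 = K' ⊕ κ 1ℚ
  Pa = powS T a
  θexpr = ((K1 ⊛ (Pa ⊛ (T ⊕ negS ((T ⊛ T) ⊛ E1)))) ⊛ E1) ⊕ ((T ⊛ Pa) ⊛ (X ⊛ E1))
  θG : θ (kernel a) ≈S θexpr
  θG = θ (kernel a) ≈⟨ θ-⊛ (powS T (suc a)) E1 ⟩
    (θ (powS T (suc a)) ⊛ E1) ⊕ (powS T (suc a) ⊛ θ E1) ≈⟨ ⊕-cong (⊛-congˡ (θ-pow T a) E1) (⊛-congʳ (powS T (suc a)) θ-E1) ⟩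
    ((K ⊛ (Pa ⊛ θ T)) ⊛ E1) ⊕ ((T ⊛ Pa) ⊛ (X ⊛ E1)) ≈⟨ ⊕-congˡ (⊛-congˡ (⊛-cong (κ-suc a) (⊛-congʳ Pa θ-T)) E1) ((T ⊛ Pa) ⊛ (X ⊛ E1)) ⟩
    θexpr ∎S

kernel-recurrence : ∀ a d → ℕ→ℚ (suc a) * kernel (suc a) d ≡ ((ℕ→ℚ (suc a) * kernel a d) + - (ℕ→ℚ d * kernel a d)) + - (ℕ→ℚ a * (X ⊛ kernel a) d)
kernel-recurrence a d = trans (sym (κ⊛-coeff (ℕ→ℚ (suc a)) (kernel (suc a)) d)) (trans (app (kernel-suc a) d)
  (cong₂ (λ u v → (u + - (ℕ→ℚ d * kernel a d)) + - v) (κ⊛-coeff (ℕ→ℚ (suc a)) (kernel a) d) (κ⊛-coeff (ℕ→ℚ a) (X ⊛ kernel a) d)))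

stirling1-diag : ∀ n → stirling1 n n ≡ + 1
stirling1-diag zero = refl
stirling1-diag (suc n) = trans (cong₂ (λ x y → x ℤ.- (+ n ℤ.* y)) (stirling1-diag n) (stirling1-above n (suc n) ℕP.≤-refl)) (cong (λ z → + 1 ℤ.- z) (ℤP.*-zeroʳ (+ n)))

stirlingCoeff-diag : ∀ n → stirlingCoeff n n ≡ 1ℚ
stirlingCoeff-diag n = trans (cong (λ z → ℕ→ℚ (n !) * ℤ→ℚ z * invFact n) (stirling1-diag n)) (trans (cong (_* invFact n) (ℚP.*-identityʳ (ℕ→ℚ (n !)))) (n!*invFact≡1 n))

T-zero : T 0 ≡ 1ℚ
T-zero = trans (sym (ℚP.*-identityˡ (T 0))) (app (⊛-invS em refl) 0)

powS-zero-coeff : ∀ f → f 0 ≡ 1ℚ → ∀ k → powS f k 0 ≡ 1ℚ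
powS-zero-coeff f f0 zero = refl
powS-zero-coeff f f0 (suc k) = trans (cong₂ _*_ f0 (powS-zero-coeff f f0 k)) refl

kernel-zero : ∀ a → kernel a 0 ≡ 1ℚ
kernel-zero a = trans (cong (_* E1 0) (powS-zero-coeff T T-zero (suc a))) refl

kernel-diag : ∀ a → kernel (suc a) (suc a) ≡ 0ℚ
kernel-diag a = suc*-cancelˡ a _ _ (begin
  ℕ→ℚ (suc a) * kernel (suc a) (suc a) ≡⟨ kernel-recurrence a (suc a) ⟩
  ((ℕ→ℚ (suc a) * kernel a (suc a)) + - (ℕ→ℚ (suc a) * kernel a (suc a))) + - (ℕ→ℚ a * (X ⊛ kernel a) (suc a)) ≡⟨ cong (λ z → ((ℕ→ℚ (suc a) * kernel a (suc a)) + - (ℕ→ℚ (suc a) * kernel a (suc a))) + - (ℕ→ℚ a * z)) (X⊛-suc (kernel a) a) ⟩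
  ((ℕ→ℚ (suc a) * kernel a (suc a)) + - (ℕ→ℚ (suc a) * kernel a (suc a))) + - (ℕ→ℚ a * kernel a a) ≡⟨ cong (λ z → ((ℕ→ℚ (suc a) * kernel a (suc a)) + - (ℕ→ℚ (suc a) * kernel a (suc a))) + - z) (NG a) ⟩
  ((ℕ→ℚ (suc a) * kernel a (suc a)) + - (ℕ→ℚ (suc a) * kernel a (suc a))) + - 0ℚ ≡⟨ QS.solve 2 (λ x y → (x :* y :+ (:- (x :* y))) :+ (:- con 0ℚ) := x :* con 0ℚ) refl (ℕ→ℚ (suc a)) (kernel a (suc a)) ⟩
  ℕ→ℚ (suc a) * 0ℚ ∎)
  where
  open QS
  NG : ∀ a → ℕ→ℚ a * kernel a a ≡ 0ℚ
  NG zero = ℚP.*-zeroˡ (kernel 0 0)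
  NG (suc a) = trans (cong (ℕ→ℚ (suc a) *_) (kernel-diag a)) (ℚP.*-zeroʳ (ℕ→ℚ (suc a)))

logPow≡kernel : ∀ a d → d ≤ a → logPow a (a ∸ d) ≡ kernel a d
logPow≡kernel zero zero _ = sym (kernel-zero 0)
logPow≡kernel (suc a) zero _ = trans (logPow≡stirlingCoeff (suc a) (suc a)) (trans (stirlingCoeff-diag (suc a)) (sym (kernel-zero (suc a))))
logPow≡kernel (suc a) (suc d) (s≤s d≤a) = aux (d ℕP.≟ a)
  where
  aux : Dec (d ≡ a) → logPow (suc a) (a ∸ d) ≡ kernel (suc a) (suc d)
  aux (yes e) = trans (cong (logPow (suc a)) (trans (cong (a ∸_) e) (ℕP.n∸n≡0 a))) (trans (sym (kernel-diag a)) (cong (kernel (suc a)) (cong suc (sym e))))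
  aux (no d≢a) = suc*-cancelˡ a _ _ (begin
      ℕ→ℚ (suc a) * logPow (suc a) (a ∸ d) ≡⟨ cong (λ z → ℕ→ℚ (suc a) * logPow (suc a) z) e1 ⟩
      ℕ→ℚ (suc a) * logPow (suc a) (suc m) ≡⟨ x+y≡z⇒x≡z-y (logPow-recurrence a m) ⟩
      ℕ→ℚ (suc m) * logPow a m - ℕ→ℚ a * logPow a (suc m) ≡⟨ cong₂ (λ x y → ℕ→ℚ (suc m) * x - ℕ→ℚ a * y) (logPow≡kernel a (suc d) sd≤a) (trans (cong (logPow a) (sym e1)) (logPow≡kernel a d d≤a)) ⟩
      ℕ→ℚ (suc m) * kernel a (suc d) - ℕ→ℚ a * kernel a d ≡⟨ cong (λ z → z * kernel a (suc d) - ℕ→ℚ a * kernel a d) e2 ⟩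
      (ℕ→ℚ (suc a) - ℕ→ℚ (suc d)) * kernel a (suc d) - ℕ→ℚ a * kernel a d ≡⟨ QS.solve 5 (λ A D g g' N' → (A :- D) :* g :- N' :* g' := ((A :* g) :+ (:- (D :* g))) :+ (:- (N' :* g'))) refl (ℕ→ℚ (suc a)) (ℕ→ℚ (suc d)) (kernel a (suc d)) (kernel a d) (ℕ→ℚ a) ⟩
      ((ℕ→ℚ (suc a) * kernel a (suc d)) + - (ℕ→ℚ (suc d) * kernel a (suc d))) + - (ℕ→ℚ a * kernel a d) ≡⟨ cong (λ z → ((ℕ→ℚ (suc a) * kernel a (suc d)) + - (ℕ→ℚ (suc d) * kernel a (suc d))) + - (ℕ→ℚ a * z)) (sym (X⊛-suc (kernel a) d)) ⟩
      ((ℕ→ℚ (suc a) * kernel a (suc d)) + - (ℕ→ℚ (suc d) * kernel a (suc d))) + - (ℕ→ℚ a * (X ⊛ kernel a) (suc d)) ≡⟨ sym (kernel-recurrence a (suc d)) ⟩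
      ℕ→ℚ (suc a) * kernel (suc a) (suc d) ∎)
    where
    open QS
    sd≤a : suc d ≤ a
    sd≤a = ℕP.≤∧≢⇒< d≤a d≢a
    m : ℕ
    m = a ∸ suc d
    e1 : a ∸ d ≡ suc m
    e1 = ℕP.+-∸-assoc 1 sd≤a
    e2 : ℕ→ℚ (suc m) ≡ ℕ→ℚ (suc a) - ℕ→ℚ (suc d)
    e2 = trans (cong ℕ→ℚ (sym e1)) (ℕ→ℚ-homo-∸ (suc a) (suc d) (s≤s d≤a))

powS-tOverOnePlusTLog-coeff : ∀ r a → powS tOverOnePlusTLog r a ≡ (powS W r ⊛ kernel a) a
powS-tOverOnePlusTLog-coeff r a = trans (app (powS-tOverOnePlusTLog r) a) (sumTo-cong≤ a (λ m m≤a → cong (powS W r m *_)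
   (trans (cong (logPow a) (sym (ℕP.m∸[m∸n]≡n m≤a))) (logPow≡kernel a (a ∸ m) (ℕP.m∸n≤m a m)))))

-- B_a^(a-r+1)(1-r) as a coefficient of (t/((1+t) log(1+t)))^r

powS-one : ∀ r → powS oneS r ≈S oneS
powS-one zero = ≈S-refl
powS-one (suc r) = ≈S-trans (⊛-congʳ oneS (powS-one r)) (⊛-identityˡ oneS)

powS-em⊛powS-T : ∀ r → powS em r ⊛ powS T r ≈S oneS
powS-em⊛powS-T r = ≈S-trans (≈S-sym (powS-⊛ em T r)) (≈S-trans (powS-cong (⊛-invS em refl) r) (powS-one r))

order-nonneg : ∀ a r k → suc a ≡ r ℕ.+ k → (+ a) ℤ.- (+ r) ℤ.+ (+ 1) ≡ + k
order-nonneg a r k e = begin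
  (+ a) ℤ.- (+ r) ℤ.+ (+ 1) ≡⟨ solve 2 (λ a r → a :- r :+ con (+ 1) := (a :+ con (+ 1)) :- r) refl (+ a) (+ r) ⟩
  ((+ a) ℤ.+ (+ 1)) ℤ.- (+ r) ≡⟨ cong (ℤ._- (+ r)) (trans (sym (ℤP.pos-+ a 1)) (cong +_ (trans (ℕP.+-comm a 1) e))) ⟩
  (+ (r ℕ.+ k)) ℤ.- (+ r) ≡⟨ cong (ℤ._- (+ r)) (ℤP.pos-+ r k) ⟩
  ((+ r) ℤ.+ (+ k)) ℤ.- (+ r) ≡⟨ solve 2 (λ r k → (r :+ k) :- r := k) refl (+ r) (+ k) ⟩
  + k ∎
  where open ZS.+-*-Solver

order-neg : ∀ a k → (+ a) ℤ.- (+ (suc a ℕ.+ suc k)) ℤ.+ (+ 1) ≡ -[1+ k ]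
order-neg a k = begin
  (+ a) ℤ.- (+ (suc a ℕ.+ suc k)) ℤ.+ (+ 1) ≡⟨ cong (λ z → (+ a) ℤ.- z ℤ.+ (+ 1)) (ℤP.pos-+ (suc a) (suc k)) ⟩
  (+ a) ℤ.- ((+ suc a) ℤ.+ (+ suc k)) ℤ.+ (+ 1) ≡⟨ cong (λ z → (+ a) ℤ.- (z ℤ.+ (+ suc k)) ℤ.+ (+ 1)) (ℤP.pos-+ 1 a) ⟩
  (+ a) ℤ.- (((+ 1) ℤ.+ (+ a)) ℤ.+ (+ suc k)) ℤ.+ (+ 1) ≡⟨ solve 2 (λ a s → a :- ((con (+ 1) :+ a) :+ s) :+ con (+ 1) := :- s) refl (+ a) (+ suc k) ⟩
  ℤ.- (+ suc k) ∎
  where open ZS.+-*-Solver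

powS-em⊛powS-T-suc : ∀ a r → powS em r ⊛ powS T (suc a) ≈S tOverExpm1Pow ((+ a) ℤ.- (+ r) ℤ.+ (+ 1))
powS-em⊛powS-T-suc a r with r ℕP.≤? suc a
... | yes r≤ = ≈S-trans body (≈S-sym (mk≈ λ n → cong (λ z → tOverExpm1Pow z n) (order-nonneg a r k e)))
  where
  k : ℕ
  k = suc a ∸ r
  e : suc a ≡ r ℕ.+ k
  e = sym (ℕP.m+[n∸m]≡n r≤)
  body : powS em r ⊛ powS T (suc a) ≈S powS T k
  body = powS em r ⊛ powS T (suc a) ≈⟨ ⊛-congʳ (powS em r) (≈S-trans (mk≈ λ n → cong (λ z → powS T z n) e) (powS-+ T r k)) ⟩
    powS em r ⊛ (powS T r ⊛ powS T k) ≈⟨ ≈S-sym (⊛-assoc (powS em r) (powS T r) (powS T k)) ⟩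
    (powS em r ⊛ powS T r) ⊛ powS T k ≈⟨ ⊛-congˡ (powS-em⊛powS-T r) (powS T k) ⟩
    oneS ⊛ powS T k ≈⟨ ⊛-identityˡ (powS T k) ⟩
    powS T k ∎S
... | no r≰ = ≈S-trans body (≈S-sym (mk≈ λ n → cong (λ z → tOverExpm1Pow z n) (trans (cong (λ z → (+ a) ℤ.- (+ z) ℤ.+ (+ 1)) e) (order-neg a k))))
  where
  k : ℕ
  k = r ∸ suc (suc a)
  e : r ≡ suc a ℕ.+ suc k
  e = trans (sym (ℕP.m+[n∸m]≡n (ℕP.≰⇒> r≰))) (sym (ℕP.+-suc (suc a) k))
  body : powS em r ⊛ powS T (suc a) ≈S powS em (suc k)
  body = powS em r ⊛ powS T (suc a) ≈⟨ ⊛-congˡ (≈S-trans (mk≈ λ n → cong (λ z → powS em z n) e) (powS-+ em (suc a) (suc k))) (powS T (suc a)) ⟩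
    (powS em (suc a) ⊛ powS em (suc k)) ⊛ powS T (suc a) ≈⟨ SeriesSolver.solve 3 (λ x y z → (x :* y) :* z := (x :* z) :* y) ≈S-refl (powS em (suc a)) (powS em (suc k)) (powS T (suc a)) ⟩
    (powS em (suc a) ⊛ powS T (suc a)) ⊛ powS em (suc k) ≈⟨ ⊛-congˡ (powS-em⊛powS-T (suc a)) (powS em (suc k)) ⟩
    oneS ⊛ powS em (suc k) ≈⟨ ⊛-identityˡ (powS em (suc k)) ⟩
    powS em (suc k) ∎S
    where open SeriesSolver

r*minus1+1 : ∀ r → r * minus1 + 1ℚ ≡ 1ℚ - r
r*minus1+1 = QS.solve 1 (λ r → r :* con minus1 :+ con 1ℚ := con 1ℚ :- r) refl
  where open QS

powS-W⊛kernel : ∀ r a → powS W r ⊛ kernel a ≈S tOverExpm1Pow ((+ a) ℤ.- (+ r) ℤ.+ (+ 1)) ⊛ expXT (1ℚ - ℕ→ℚ r)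
powS-W⊛kernel r a = powS W r ⊛ kernel a ≈⟨ ⊛-congˡ (≈S-trans (powS-⊛ em Em1 r) (⊛-congʳ (powS em r) (powS-expXT minus1 r))) (kernel a) ⟩
  (powS em r ⊛ expXT (ℕ→ℚ r * minus1)) ⊛ (powS T (suc a) ⊛ E1) ≈⟨ SeriesSolver.solve 4 (λ x y z w → (x :* y) :* (z :* w) := (x :* z) :* (y :* w)) ≈S-refl (powS em r) (expXT (ℕ→ℚ r * minus1)) (powS T (suc a)) E1 ⟩
  (powS em r ⊛ powS T (suc a)) ⊛ (expXT (ℕ→ℚ r * minus1) ⊛ E1) ≈⟨ ⊛-cong (powS-em⊛powS-T-suc a r) (≈S-trans (expXT-+ (ℕ→ℚ r * minus1) 1ℚ) (expXT-cong (r*minus1+1 (ℕ→ℚ r)))) ⟩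
  tOverExpm1Pow ((+ a) ℤ.- (+ r) ℤ.+ (+ 1)) ⊛ expXT (1ℚ - ℕ→ℚ r) ∎S
  where open SeriesSolver

bernoulliOrd≡factorial*powS-tOverOnePlusTLog : ∀ r a →
  bernoulliOrd a ((+ a) ℤ.- (+ r) ℤ.+ (+ 1)) (1ℚ - ℕ→ℚ r) ≡ ℕ→ℚ (a !) * powS tOverOnePlusTLog r a
bernoulliOrd≡factorial*powS-tOverOnePlusTLog r a =
  cong (ℕ→ℚ (a !) *_) (sym (trans (powS-tOverOnePlusTLog-coeff r a) (app (powS-W⊛kernel r a) a)))

nCk*k!*[n∸k]!≡n! : ∀ n m → m ≤ n → (n C m) ℕ.* (m ! ℕ.* (n ∸ m) !) ≡ n !
nCk*k!*[n∸k]!≡n! n m m≤n = trans (cong (ℕ._* (m ! ℕ.* (n ∸ m) !)) (nCk≡n!/k![n-k]! m≤n))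
  (ℕD.m/n*n≡m {{ℕP._!*_!≢0 m (n ∸ m)}} (k![n∸k]!∣n! m≤n))

ℕ→ℚ-nCk*k!*[n∸k]! : ∀ n m → m ≤ n → ℕ→ℚ (n C m) * (ℕ→ℚ (m !) * ℕ→ℚ ((n ∸ m) !)) ≡ ℕ→ℚ (n !)
ℕ→ℚ-nCk*k!*[n∸k]! n m m≤n = begin
  ℕ→ℚ (n C m) * (ℕ→ℚ (m !) * ℕ→ℚ ((n ∸ m) !)) ≡⟨ cong (ℕ→ℚ (n C m) *_) (sym (ℕ→ℚ-homo-* (m !) ((n ∸ m) !))) ⟩
  ℕ→ℚ (n C m) * ℕ→ℚ (m ! ℕ.* (n ∸ m) !)       ≡⟨ sym (ℕ→ℚ-homo-* (n C m) _) ⟩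
  ℕ→ℚ ((n C m) ℕ.* (m ! ℕ.* (n ∸ m) !))       ≡⟨ cong ℕ→ℚ (nCk*k!*[n∸k]!≡n! n m m≤n) ⟩
  ℕ→ℚ (n !) ∎

nCk*[n∸k]!≡n!*invFact : ∀ n m → m ≤ n → ℕ→ℚ (n C m) * ℕ→ℚ ((n ∸ m) !) ≡ ℕ→ℚ (n !) * invFact m
nCk*[n∸k]!≡n!*invFact n m m≤n = begin
  ℕ→ℚ (n C m) * ℕ→ℚ ((n ∸ m) !)
    ≡⟨ sym (ℚP.*-identityʳ _) ⟩
  (ℕ→ℚ (n C m) * ℕ→ℚ ((n ∸ m) !)) * 1ℚ
    ≡⟨ cong ((ℕ→ℚ (n C m) * ℕ→ℚ ((n ∸ m) !)) *_) (sym (n!*invFact≡1 m)) ⟩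
  (ℕ→ℚ (n C m) * ℕ→ℚ ((n ∸ m) !)) * (ℕ→ℚ (m !) * invFact m)
    ≡⟨ QS.solve 4 (λ c f g i → (c :* f) :* (g :* i) := (c :* (g :* f)) :* i) refl
         (ℕ→ℚ (n C m)) (ℕ→ℚ ((n ∸ m) !)) (ℕ→ℚ (m !)) (invFact m) ⟩
  (ℕ→ℚ (n C m) * (ℕ→ℚ (m !) * ℕ→ℚ ((n ∸ m) !))) * invFact m
    ≡⟨ cong (_* invFact m) (ℕ→ℚ-nCk*k!*[n∸k]! n m m≤n) ⟩
  ℕ→ℚ (n !) * invFact m ∎
  where open QS

binomialConvolution : ∀ N (f g : Series) →
  sumTo N (λ a → ℕ→ℚ (N C a) * (ℕ→ℚ (a !) * f a) * (ℕ→ℚ ((N ∸ a) !) * g (N ∸ a)))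
    ≡ ℕ→ℚ (N !) * (f ⊛ g) N
binomialConvolution N f g = trans (sumTo-cong≤ N term) (sym (sumTo-*ˡ N (ℕ→ℚ (N !)) _))
  where
  term : ∀ a → a ≤ N → ℕ→ℚ (N C a) * (ℕ→ℚ (a !) * f a) * (ℕ→ℚ ((N ∸ a) !) * g (N ∸ a))
                       ≡ ℕ→ℚ (N !) * (f a * g (N ∸ a))
  term a a≤N = begin
    ℕ→ℚ (N C a) * (ℕ→ℚ (a !) * f a) * (ℕ→ℚ ((N ∸ a) !) * g (N ∸ a))
      ≡⟨ QS.solve 5 (λ c u x v y → c :* (u :* x) :* (v :* y) := (c :* (u :* v)) :* (x :* y)) refl
           (ℕ→ℚ (N C a)) (ℕ→ℚ (a !)) (f a) (ℕ→ℚ ((N ∸ a) !)) (g (N ∸ a)) ⟩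
    (ℕ→ℚ (N C a) * (ℕ→ℚ (a !) * ℕ→ℚ ((N ∸ a) !))) * (f a * g (N ∸ a))
      ≡⟨ cong (_* (f a * g (N ∸ a))) (ℕ→ℚ-nCk*k!*[n∸k]! N a a≤N) ⟩
    ℕ→ℚ (N !) * (f a * g (N ∸ a)) ∎
    where open QS

module _ (r : ℕ) (k : ℤ) where

  private
    Q : Series
    Q = powS tOverOnePlusTLog r ⊛ lifNegLog k

  stirlingTerm : ℕ → ℕ → ℕ → ℚ
  stirlingTerm n i j = ℤ→ℚ (stirling1 i j) * invFact i * Q (n ∸ i)

  Atilde≡stirlingTerm-sum : ∀ n x →
    Atilde r k n x ≡ ℕ→ℚ (n !) * sumTo n (λ i → sumTo i (λ j → stirlingTerm n i j * (x ^ℚ j)))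
  Atilde≡stirlingTerm-sum n x = cong (ℕ→ℚ (n !) *_) (begin
    (Q ⊛ onePlusTPow x) n ≡⟨ app (⊛-comm Q (onePlusTPow x)) n ⟩
    (onePlusTPow x ⊛ Q) n ≡⟨ sumTo-cong n row ⟨
    sumTo n (λ i → sumTo i (λ j → stirlingTerm n i j * (x ^ℚ j))) ∎)
    where
    row : ∀ i → sumTo i (λ j → stirlingTerm n i j * (x ^ℚ j)) ≡ onePlusTPow x i * Q (n ∸ i)
    row i = begin
      sumTo i (λ j → stirlingTerm n i j * (x ^ℚ j))
        ≡⟨ sumTo-cong i (λ j → QS.solve 4 (λ s f q y → s :* f :* q :* y := y :* s :* f :* q) refl
                                 (ℤ→ℚ (stirling1 i j)) (invFact i) (Q (n ∸ i)) (x ^ℚ j)) ⟩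
      sumTo i (λ j → (x ^ℚ j) * ℤ→ℚ (stirling1 i j) * invFact i * Q (n ∸ i))
        ≡⟨ sumTo-*ʳ i (Q (n ∸ i)) _ ⟨
      sumTo i (λ j → (x ^ℚ j) * ℤ→ℚ (stirling1 i j) * invFact i) * Q (n ∸ i)
        ≡⟨ cong (_* Q (n ∸ i)) (trans (sym (sumTo-*ʳ i (invFact i) _)) (sym (onePlusTPow-coef x i))) ⟩
      onePlusTPow x i * Q (n ∸ i) ∎
      where open QS

  bernoulliCauchy-sum : ∀ n j l → l ℕ.+ j ≤ n →
    sumTo (n ∸ j ∸ l) (λ a →
        ℕ→ℚ (n C (l ℕ.+ j)) * ℕ→ℚ ((n ∸ j ∸ l) C a)
          * ℤ→ℚ (stirling1 (l ℕ.+ j) j)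
          * bernoulliOrd a ((+ a) ℤ.- (+ r) ℤ.+ (+ 1)) (1ℚ - ℕ→ℚ r)
          * polyCauchy2 (n ∸ j ∸ l ∸ a) k)
      ≡ ℕ→ℚ (n !) * stirlingTerm n (l ℕ.+ j) j
  bernoulliCauchy-sum n j l m≤n = begin
    sumTo N (λ a → c * ℕ→ℚ (N C a) * S * bernoulliOrd a ((+ a) ℤ.- (+ r) ℤ.+ (+ 1)) (1ℚ - ℕ→ℚ r) * polyCauchy2 (N ∸ a) k)
      ≡⟨ sumTo-cong N (λ a → cong (λ z → c * ℕ→ℚ (N C a) * S * z * polyCauchy2 (N ∸ a) k)
                                  (bernoulliOrd≡factorial*powS-tOverOnePlusTLog r a)) ⟩
    sumTo N (λ a → c * ℕ→ℚ (N C a) * S * (ℕ→ℚ (a !) * P a) * (ℕ→ℚ ((N ∸ a) !) * lifNegLog k (N ∸ a)))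
      ≡⟨ sumTo-cong N (λ a → QS.solve 5 (λ c S b u v → c :* b :* S :* u :* v := (c :* S) :* (b :* u :* v)) refl
                                        c S (ℕ→ℚ (N C a)) (ℕ→ℚ (a !) * P a) (ℕ→ℚ ((N ∸ a) !) * lifNegLog k (N ∸ a))) ⟩
    sumTo N (λ a → (c * S) * (ℕ→ℚ (N C a) * (ℕ→ℚ (a !) * P a) * (ℕ→ℚ ((N ∸ a) !) * lifNegLog k (N ∸ a))))
      ≡⟨ trans (sym (sumTo-*ˡ N (c * S) _)) (cong ((c * S) *_) (binomialConvolution N P (lifNegLog k))) ⟩
    (c * S) * (ℕ→ℚ (N !) * Q N)
      ≡⟨ cong (λ z → (c * S) * (ℕ→ℚ (z !) * Q z)) N≡n∸m ⟩
    (c * S) * (ℕ→ℚ ((n ∸ m) !) * Q (n ∸ m))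
      ≡⟨ QS.solve 4 (λ c S f q → (c :* S) :* (f :* q) := (c :* f) :* (S :* q)) refl c S (ℕ→ℚ ((n ∸ m) !)) (Q (n ∸ m)) ⟩
    (c * ℕ→ℚ ((n ∸ m) !)) * (S * Q (n ∸ m))
      ≡⟨ cong (_* (S * Q (n ∸ m))) (nCk*[n∸k]!≡n!*invFact n m m≤n) ⟩
    (ℕ→ℚ (n !) * invFact m) * (S * Q (n ∸ m))
      ≡⟨ QS.solve 4 (λ f i S q → (f :* i) :* (S :* q) := f :* (S :* i :* q)) refl (ℕ→ℚ (n !)) (invFact m) S (Q (n ∸ m)) ⟩
    ℕ→ℚ (n !) * stirlingTerm n m j ∎
    where
    open QS
    P : Series
    P = powS tOverOnePlusTLog r
    m N : ℕ
    m = l ℕ.+ j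
    N = n ∸ j ∸ l
    c S : ℚ
    c = ℕ→ℚ (n C m)
    S = ℤ→ℚ (stirling1 m j)
    N≡n∸m : N ≡ n ∸ m
    N≡n∸m = trans (ℕP.∸-+-assoc n j l) (cong (n ∸_) (ℕP.+-comm j l))

theorem3 : (r : ℕ) (k : ℤ) (n : ℕ) (x : ℚ) →
    Atilde r k n x ≡
      sumTo n (λ j →
        sumTo (n ∸ j) (λ l →
          sumTo (n ∸ j ∸ l) (λ a →
            ℕ→ℚ (n C (l ℕ.+ j)) * ℕ→ℚ ((n ∸ j ∸ l) C a)
              * ℤ→ℚ (stirling1 (l ℕ.+ j) j)
              * bernoulliOrd a ((+ a) ℤ.- (+ r) ℤ.+ (+ 1)) (1ℚ - ℕ→ℚ r)
              * polyCauchy2 (n ∸ j ∸ l ∸ a) k))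
        * (x ^ℚ j))
theorem3 r k n x = begin
  Atilde r k n x
    ≡⟨ Atilde≡stirlingTerm-sum r k n x ⟩
  n! * sumTo n (λ i → sumTo i (λ j → H i j * (x ^ℚ j)))
    ≡⟨ cong (n! *_) (sumTo-triangle n (λ i j → H i j * (x ^ℚ j))) ⟩
  n! * sumTo n (λ j → sumTo (n ∸ j) (λ l → H (l ℕ.+ j) j * (x ^ℚ j)))
    ≡⟨ trans (sumTo-*ˡ n n! _) (sumTo-cong n (λ j → trans (cong (n! *_) (sym (sumTo-*ʳ (n ∸ j) (x ^ℚ j) _)))
                                                   (sym (ℚP.*-assoc n! _ (x ^ℚ j))))) ⟩
  sumTo n (λ j → n! * sumTo (n ∸ j) (λ l → H (l ℕ.+ j) j) * (x ^ℚ j))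
    ≡⟨ sumTo-cong≤ n (λ j j≤n → cong (_* (x ^ℚ j)) (trans (sumTo-*ˡ (n ∸ j) n! _)
         (sumTo-cong≤ (n ∸ j) (λ l l≤n∸j → sym (bernoulliCauchy-sum r k n j l (l+j≤n j≤n l≤n∸j)))))) ⟩
  _ ∎
  where
  n! : ℚ
  n! = ℕ→ℚ (n !)
  H : ℕ → ℕ → ℚ
  H = stirlingTerm r k n
  l+j≤n : ∀ {j l} → j ≤ n → l ≤ n ∸ j → l ℕ.+ j ≤ n
  l+j≤n {j} j≤n l≤n∸j = ℕP.≤-trans (ℕP.+-monoˡ-≤ j l≤n∸j) (ℕP.≤-reflexive (ℕP.m∸n+n≡m j≤n))
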